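{- Writing $N_{A_l}:=N_{G^{dual+}_{A_l}}$ etc., the following hold. For all $l\ge1$, \[ (l+3)N_{A_{l+2}}(t) = -(2l+3)(2t-1) N_{A_{l+1}}(t) - l\, N_{A_l}(t). \] For all $l\ge2$, \[ (l+2)N_{B_{l+2}}(t) = -(2l+3)\Big\{2t-\frac{2(2l^2+4l+1)}{(2l+1)(2l+3)}\Big\} N_{B_{l+1}}(t) - \frac{l(2l+3)}{2l+1}N_{B_{l}}(t). \] For all $l\ge4$, \[ N_{D_{l+3}}(t) = (a_{l} + b_{l} t) N_{D_{l+2}}(t) +(c_{l} + d_{l} t + e_{l} t^2) N_{D_{l+1}}(t) + (f_{l} + g_{l} t) N_{D_l}(t), \] where, with $Q_l:=(l+3)(43l^3-35l^2-36l-32)$, $a_l=\frac{(l+2)(43l^3-78l^2-129l-24)}{Q_l}$, $b_l=-\frac{86l^4+145l^3-196l^2-623l-456}{Q_l}$, $c_l=\frac{l(43l^3+180l^2+45l+56)}{Q_l}$, $d_l=-\frac{2l(172l^3+333l^2-23l-32)}{Q_l}$, $e_l=\frac{2(2l-1)(2l+1)(43l^2+51l-24)}{Q_l}$, $f_l=-\frac{(l-1)(43l^3+137l^2+38l-48)}{Q_l}$, $g_l=\frac{(l-1)(2l+1)(43l^2+51l-24)}{Q_l}$.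
   Context: For a finite Coxeter type $P$ with Coxeter system $(W,S)$, set of reflections $T$, reflection length $\ell_T$, order $g\le_T h\iff \ell_T(g)+\ell_T(g^{ -1}h)=\ell_T(h)$, and bipartite Coxeter element $c$, the dual Artin monoid $G^{dual+}_P$ is the monoid generated by $T$ with relations $r\cdot s=(rsr^{ -1})\cdot r$ for all $r,s\in T$ with $rs\le_T c$; it is graded by word length $\deg$ and is a lattice for left divisibility. Its skew-growth function is $N_{G^{dual+}_P}(t)=\sum_{J\subseteq T}(-1)^{|J|}t^{\deg(\mathrm{lcm}(J))}$. It is known that $N_{G^{dual +}_{A_l}}(t)=\sum_{k=0}^{l} (-1)^{k}\frac{1}{l}\binom {l}{k}\binom {l+k}{k+1}t^k$ ($l\ge1$), $N_{G^{dual +}_{B_l}}(t)=\sum_{k=0}^{l} (-1)^{k}\binom {l}{k}\binom {l+k-1}{k}t^k$ ($l\ge2$), $N_{G^{dual +}_{D_l}}(t)=\sum_{k=0}^{l} (-1)^{k} \big( \binom {l}{k}\binom {l+k-2}{k} + \binom {l-2}{k-2}\binom {l+k-3}{k}\big) t^k$ ($l\ge4$). -}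

module Defs where

open import Data.Nat as ℕ using (ℕ; zero; suc)
open import Data.Nat.Combinatorics using (_C_)
open import Data.Integer as ℤ using (+_)
open import Data.Rational as ℚ using (ℚ; _÷_; 0ℚ; 1ℚ)
open import Data.Rational.Properties as ℚP using ()
open import Relation.Nullary using (yes; no)

q : ℕ → ℚ
q n = (+ n) ℚ./ 1

-- total division on ℚ: p / r when r ≠ 0 (only ever used with r ≠ 0 below)
_÷'_ : ℚ → ℚ → ℚ
p ÷' r with r ℚP.≟ 0ℚ
... | yes _ = 0ℚ
... | no r≢0 = _÷_ p r {{ℚ.≢-nonZero r≢0}}

_^'_ : ℚ → ℕ → ℚ
t ^' zero = 1ℚ
t ^' suc k = t ℚ.* (t ^' k)

sgn : ℕ → ℚ
sgn zero = 1ℚ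
sgn (suc k) = ℚ.- sgn k

sumTo : ℕ → (ℕ → ℚ) → ℚ
sumTo zero f = f 0
sumTo (suc n) f = sumTo n f ℚ.+ f (suc n)

binomShift2 : ℕ → ℕ → ℕ
binomShift2 n zero = 0
binomShift2 n (suc zero) = 0
binomShift2 n (suc (suc k)) = (n ℕ.∸ 2) C k

-- Skew-growth functions of the dual Artin monoids, via the known closed formulas
-- (see context), as polynomial functions ℚ → ℚ.

NA : ℕ → ℚ → ℚ
NA l t = sumTo l (λ k → sgn k ℚ.* ((q ((l C k) ℕ.* ((l ℕ.+ k) C (suc k))) ÷' q l) ℚ.* (t ^' k)))

NB : ℕ → ℚ → ℚ
NB l t = sumTo l (λ k → sgn k ℚ.* (q ((l C k) ℕ.* ((l ℕ.+ k ℕ.∸ 1) C k)) ℚ.* (t ^' k)))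

ND : ℕ → ℚ → ℚ
ND l t = sumTo l (λ k → sgn k ℚ.*
  (q ((l C k) ℕ.* ((l ℕ.+ k ℕ.∸ 2) C k) ℕ.+ binomShift2 l k ℕ.* ((l ℕ.+ k ℕ.∸ 3) C k)) ℚ.* (t ^' k)))

private
  L : ℕ → ℚ
  L = q

Qd : ℕ → ℚ
Qd l = (L l ℚ.+ q 3) ℚ.* (q 43 ℚ.* (L l ^' 3) ℚ.- q 35 ℚ.* (L l ^' 2) ℚ.- q 36 ℚ.* L l ℚ.- q 32)

aD bD cD dD eD fD gD : ℕ → ℚ
aD l = ((L l ℚ.+ q 2) ℚ.* (q 43 ℚ.* (L l ^' 3) ℚ.- q 78 ℚ.* (L l ^' 2) ℚ.- q 129 ℚ.* L l ℚ.- q 24)) ÷' Qd l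
bD l = ℚ.- ((q 86 ℚ.* (L l ^' 4) ℚ.+ q 145 ℚ.* (L l ^' 3) ℚ.- q 196 ℚ.* (L l ^' 2) ℚ.- q 623 ℚ.* L l ℚ.- q 456) ÷' Qd l)
cD l = (L l ℚ.* (q 43 ℚ.* (L l ^' 3) ℚ.+ q 180 ℚ.* (L l ^' 2) ℚ.+ q 45 ℚ.* L l ℚ.+ q 56)) ÷' Qd l
dD l = ℚ.- ((q 2 ℚ.* L l ℚ.* (q 172 ℚ.* (L l ^' 3) ℚ.+ q 333 ℚ.* (L l ^' 2) ℚ.- q 23 ℚ.* L l ℚ.- q 32)) ÷' Qd l)
eD l = (q 2 ℚ.* (q 2 ℚ.* L l ℚ.- q 1) ℚ.* (q 2 ℚ.* L l ℚ.+ q 1) ℚ.* (q 43 ℚ.* (L l ^' 2) ℚ.+ q 51 ℚ.* L l ℚ.- q 24)) ÷' Qd l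
fD l = ℚ.- (((L l ℚ.- q 1) ℚ.* (q 43 ℚ.* (L l ^' 3) ℚ.+ q 137 ℚ.* (L l ^' 2) ℚ.+ q 38 ℚ.* L l ℚ.- q 48)) ÷' Qd l)
gD l = ((L l ℚ.- q 1) ℚ.* (q 2 ℚ.* L l ℚ.+ q 1) ℚ.* (q 43 ℚ.* (L l ^' 2) ℚ.+ q 51 ℚ.* L l ℚ.- q 24)) ÷' Qd l

{-# OPTIONS --safe #-}
module Submission where

-- The coefficient of t^k in N_{A_l}, N_{B_l}, N_{D_l} is (-1)^k times a hypergeometric term:
-- a polynomial in l and k times (l+k-c)! / (k!² (l-k)!), or (l+k)! / (k! (k+1)! (l-k)!) for A.
-- Within one recurrence, all coefficients of t^k, including those coming from the factors t
-- and t², are polynomial multiples of a single such term, so comparing coefficients reduces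
-- the recurrence to a polynomial identity in l and k; for B and D the denominators are cleared
-- first.  Reading 1/(l-k)! as 0 for k > l keeps the rule 1/(l-k-1)! = (l-k) · 1/(l-k)! valid
-- for every k, so the coefficients at the ends of the range need no separate treatment.

open import Defs
open import Data.Nat using (ℕ; _≤_)
open import Data.Rational using (ℚ; _+_; _*_; _-_; -_)
open import Data.Product using (_×_)
open import Relation.Binary.PropositionalEquality using (_≡_)

open import Data.Empty using (⊥-elim)
import Data.Integer as ℤ
import Data.Integer.Properties as ℤ
open import Data.List.Base using (List; []; _∷_; length)
open import Data.Nat as ℕ using (zero; suc; _!; _<_; s≤s; z≤n)
import Data.Nat.Properties as ℕ
open import Data.Nat.Coprimality as Coprime using ()
open import Data.Nat.Combinatorics using (_C_; k>n⇒nCk≡0; nCk≡n!/k![n-k]!; k![n∸k]!∣n!)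
open import Data.Nat.DivMod using (m/n*n≡m)
import Data.Nat.Tactic.RingSolver as ℕ-Solver
open import Data.Product using (_,_)
open import Data.Rational as ℚ using (0ℚ; 1ℚ; mkℚ)
open import Data.Rational.Properties as ℚ using (+-*-commutativeRing)
open import Level using (0ℓ)
open import Relation.Binary.PropositionalEquality
  using (_≢_; refl; sym; trans; cong; cong₂; module ≡-Reasoning)
open import Relation.Nullary using (yes; no)
open import Relation.Nullary.Decidable using (dec⇒maybe)
open import Tactic.RingSolver using (solve-∀; solve)
open import Tactic.RingSolver.Core.AlmostCommutativeRing
  using (AlmostCommutativeRing; fromCommutativeRing)

open ≡-Reasoning

ℚ-ring : AlmostCommutativeRing 0ℓ 0ℓ
ℚ-ring = fromCommutativeRing +-*-commutativeRing (λ x → dec⇒maybe (0ℚ ℚ.≟ x))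

q≡mkℚ : ∀ n → q n ≡ mkℚ (ℤ.+ n) 0 (Coprime.sym (Coprime.1-coprimeTo n))
q≡mkℚ n = ℚ.normalize-coprime _

q-suc : ∀ n → q (suc n) ≡ 1ℚ + q n
q-suc n = trans (cong (λ i → (ℤ.+ 1 ℤ.+ i) ℚ./ 1) (sym (ℤ.*-identityʳ (ℤ.+ n)))) (cong (1ℚ +_) (sym (q≡mkℚ n)))

-- Unlike q, ι (c + n) reduces to 1ℚ + (⋯ + ι n), so the shifted indices occurring below
-- need no casts before ring normalisation.
ι : ℕ → ℚ
ι zero = 0ℚ
ι (suc n) = 1ℚ + ι n

ι≡q : ∀ n → ι n ≡ q n
ι≡q zero = refl
ι≡q (suc n) = trans (cong (1ℚ +_) (ι≡q n)) (sym (q-suc n))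

ι-+ : ∀ m n → ι (m ℕ.+ n) ≡ ι m + ι n
ι-+ zero n = sym (ℚ.+-identityˡ (ι n))
ι-+ (suc m) n = trans (cong (1ℚ +_) (ι-+ m n)) (sym (ℚ.+-assoc 1ℚ (ι m) (ι n)))

ι-* : ∀ m n → ι (m ℕ.* n) ≡ ι m * ι n
ι-* zero n = sym (ℚ.*-zeroˡ (ι n))
ι-* (suc m) n = begin
  ι (n ℕ.+ m ℕ.* n)   ≡⟨ ι-+ n (m ℕ.* n) ⟩
  ι n + ι (m ℕ.* n)   ≡⟨ cong (ι n +_) (ι-* m n) ⟩
  ι n + ι m * ι n     ≡⟨ distrib (ι n) (ι m) ⟩
  (1ℚ + ι m) * ι n    ∎
  where
  distrib : ∀ a b → a + b * a ≡ (1ℚ + b) * a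
  distrib = solve-∀ ℚ-ring

ι≢0 : ∀ n → .{{ℕ.NonZero n}} → ι n ≢ 0ℚ
ι≢0 n@(suc _) ι≡0 with trans (sym (trans (ι≡q n) (q≡mkℚ n))) ι≡0
... | ()

q≢0 : ∀ n → .{{ℕ.NonZero n}} → q n ≢ 0ℚ
q≢0 n q≡0 = ι≢0 n (trans (ι≡q n) q≡0)

q-+suc≢0 : ∀ m n → q (m ℕ.+ suc n) ≢ 0ℚ
q-+suc≢0 m n = q≢0 (m ℕ.+ suc n) {{ℕ.≢-nonZero (ℕ.m+1+n≢0 m)}}

q-+ : ∀ m n → q (m ℕ.+ n) ≡ q m + q n
q-+ m n = trans (sym (ι≡q (m ℕ.+ n))) (trans (ι-+ m n) (cong₂ _+_ (ι≡q m) (ι≡q n)))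

q-* : ∀ m n → q (m ℕ.* n) ≡ q m * q n
q-* m n = trans (sym (ι≡q (m ℕ.* n))) (trans (ι-* m n) (cong₂ _*_ (ι≡q m) (ι≡q n)))

q-linear : ∀ a b l → q (a ℕ.* l ℕ.+ b) ≡ ι a * ι l + ι b
q-linear a b l = trans (sym (ι≡q (a ℕ.* l ℕ.+ b))) (trans (ι-+ (a ℕ.* l) b) (cong (_+ ι b) (ι-* a l)))

q-quadratic : ∀ a b c l → q (a ℕ.* l ℕ.* l ℕ.+ b ℕ.* l ℕ.+ c) ≡ ι a * ι l * ι l + ι b * ι l + ι c
q-quadratic a b c l = begin
  q (a ℕ.* l ℕ.* l ℕ.+ b ℕ.* l ℕ.+ c)      ≡⟨ sym (ι≡q (a ℕ.* l ℕ.* l ℕ.+ b ℕ.* l ℕ.+ c)) ⟩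
  ι (a ℕ.* l ℕ.* l ℕ.+ b ℕ.* l ℕ.+ c)      ≡⟨ ι-+ (a ℕ.* l ℕ.* l ℕ.+ b ℕ.* l) c ⟩
  ι (a ℕ.* l ℕ.* l ℕ.+ b ℕ.* l) + ι c      ≡⟨ cong (_+ ι c) (ι-+ (a ℕ.* l ℕ.* l) (b ℕ.* l)) ⟩
  ι (a ℕ.* l ℕ.* l) + ι (b ℕ.* l) + ι c    ≡⟨ cong₂ (λ x y → x + y + ι c) (trans (ι-* (a ℕ.* l) l) (cong (_* ι l) (ι-* a l))) (ι-* b l) ⟩
  ι a * ι l * ι l + ι b * ι l + ι c        ∎

÷'-as-* : ∀ p r → p ÷' r ≡ p * (1ℚ ÷' r)
÷'-as-* p r with r ℚ.≟ 0ℚ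
... | yes _ = sym (ℚ.*-zeroʳ p)
... | no _ = cong (p *_) (sym (ℚ.*-identityˡ _))

*-1÷'-inverse : ∀ r → r ≢ 0ℚ → r * (1ℚ ÷' r) ≡ 1ℚ
*-1÷'-inverse r r≢0 with r ℚ.≟ 0ℚ
... | yes r≡0 = ⊥-elim (r≢0 r≡0)
... | no r≢0′ = trans (cong (r *_) (ℚ.*-identityˡ _)) (ℚ.*-inverseʳ r {{ℚ.≢-nonZero r≢0′}})

*-÷'-cancel : ∀ r p → r ≢ 0ℚ → r * (p ÷' r) ≡ p
*-÷'-cancel r p r≢0 = begin
  r * (p ÷' r)            ≡⟨ cong (r *_) (÷'-as-* p r) ⟩
  r * (p * (1ℚ ÷' r))     ≡⟨ swap r p (1ℚ ÷' r) ⟩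
  p * (r * (1ℚ ÷' r))     ≡⟨ cong (p *_) (*-1÷'-inverse r r≢0) ⟩
  p * 1ℚ                  ≡⟨ ℚ.*-identityʳ p ⟩
  p                       ∎
  where
  swap : ∀ a b c → a * (b * c) ≡ b * (a * c)
  swap = solve-∀ ℚ-ring

*-neg-÷'-cancel : ∀ r p → r ≢ 0ℚ → r * - (p ÷' r) ≡ - p
*-neg-÷'-cancel r p r≢0 = trans (sym (ℚ.neg-distribʳ-* r (p ÷' r))) (cong -_ (*-÷'-cancel r p r≢0))

*-cancelˡ : ∀ {r x y} → r ≢ 0ℚ → r * x ≡ r * y → x ≡ y
*-cancelˡ {r} {x} {y} r≢0 rx≡ry = begin
  x                          ≡⟨ rescale x ⟩
  (1ℚ ÷' r) * (r * x)        ≡⟨ cong ((1ℚ ÷' r) *_) rx≡ry ⟩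
  (1ℚ ÷' r) * (r * y)        ≡⟨ sym (rescale y) ⟩
  y                          ∎
  where
  reassoc : ∀ i a b → i * (a * b) ≡ a * i * b
  reassoc = solve-∀ ℚ-ring
  rescale : ∀ z → z ≡ (1ℚ ÷' r) * (r * z)
  rescale z = sym (trans (reassoc (1ℚ ÷' r) r z) (trans (cong (_* z) (*-1÷'-inverse r r≢0)) (ℚ.*-identityˡ z)))

*-÷'-cancelʳ : ∀ r x → r ≢ 0ℚ → (r * x) ÷' r ≡ x
*-÷'-cancelʳ r x r≢0 = *-cancelˡ r≢0 (*-÷'-cancel r (r * x) r≢0)

*-≢0 : ∀ {a b} → a ≢ 0ℚ → b ≢ 0ℚ → a * b ≢ 0ℚ
*-≢0 {a} a≢0 b≢0 ab≡0 = b≢0 (*-cancelˡ a≢0 (trans ab≡0 (sym (ℚ.*-zeroʳ a))))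

-- Factorials and binomial coefficients

invFact : ℕ → ℚ
invFact n = 1ℚ ÷' ι (n !)

!-invFact : ∀ n → ι (n !) * invFact n ≡ 1ℚ
!-invFact n = *-1÷'-inverse (ι (n !)) (ι≢0 (n !) {{ℕ._!≢0 n}})

ι-!-suc : ∀ n → ι (suc n !) ≡ ι (suc n) * ι (n !)
ι-!-suc n = ι-* (suc n) (n !)

ι-!-suc² : ∀ n → ι ((2 ℕ.+ n) !) ≡ ι (2 ℕ.+ n) * (ι (1 ℕ.+ n) * ι (n !))
ι-!-suc² n = trans (ι-!-suc (suc n)) (cong (ι (2 ℕ.+ n) *_) (ι-!-suc n))

invFact-suc : ∀ n → invFact n ≡ ι (suc n) * invFact (suc n)
invFact-suc n = begin
  invFact n                                           ≡⟨ sym (ℚ.*-identityʳ (invFact n)) ⟩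
  invFact n * 1ℚ                                      ≡⟨ cong (invFact n *_) (sym (!-invFact (suc n))) ⟩
  invFact n * (ι (suc n !) * invFact (suc n))         ≡⟨ cong (λ x → invFact n * (x * invFact (suc n))) (ι-!-suc n) ⟩
  invFact n * (ι (suc n) * ι (n !) * invFact (suc n)) ≡⟨ regroup (invFact n) (ι (suc n)) (ι (n !)) (invFact (suc n)) ⟩
  ι (suc n) * invFact (suc n) * (ι (n !) * invFact n) ≡⟨ cong (ι (suc n) * invFact (suc n) *_) (!-invFact n) ⟩
  ι (suc n) * invFact (suc n) * 1ℚ                    ≡⟨ ℚ.*-identityʳ _ ⟩
  ι (suc n) * invFact (suc n)                         ∎
  where
  regroup : ∀ i s f j → i * (s * f * j) ≡ s * j * (f * i)
  regroup = solve-∀ ℚ-ring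

-- 1/(n - k)!, read as 0 when k > n.
invFactDiff : ℕ → ℕ → ℚ
invFactDiff n zero = invFact n
invFactDiff zero (suc k) = 0ℚ
invFactDiff (suc n) (suc k) = invFactDiff n k

invFactDiff-≤ : ∀ {n k} → k ℕ.≤ n → invFactDiff n k ≡ invFact (n ℕ.∸ k)
invFactDiff-≤ {n} {zero} z≤n = refl
invFactDiff-≤ {suc n} {suc k} (s≤s k≤n) = invFactDiff-≤ k≤n

invFactDiff-> : ∀ {n k} → n < k → invFactDiff n k ≡ 0ℚ
invFactDiff-> {zero} {suc k} _ = refl
invFactDiff-> {suc n} {suc k} (s≤s n<k) = invFactDiff-> n<k

invFactDiff-+ : ∀ p k → invFactDiff (p ℕ.+ k) k ≡ invFact p
invFactDiff-+ p k = trans (invFactDiff-≤ (ℕ.m≤n+m k p)) (cong invFact (ℕ.m+n∸n≡m p k))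

invFactDiff-suc : ∀ n k → invFactDiff n (suc k) ≡ (ι n - ι k) * invFactDiff n k
invFactDiff-suc zero zero = sym (ℚ.*-zeroˡ (invFact 0))
invFactDiff-suc zero (suc k) = sym (ℚ.*-zeroʳ (ι 0 - ι (suc k)))
invFactDiff-suc (suc n) zero = trans (invFact-suc n) (cong (_* invFact (suc n)) (sym (ℚ.+-identityʳ (ι (suc n)))))
invFactDiff-suc (suc n) (suc k) = begin
  invFactDiff n (suc k)                       ≡⟨ invFactDiff-suc n k ⟩
  (ι n - ι k) * invFactDiff n k               ≡⟨ cong (_* invFactDiff n k) (shift-both (ι n) (ι k)) ⟩
  (ι (suc n) - ι (suc k)) * invFactDiff n k   ∎
  where
  shift-both : ∀ a b → a - b ≡ (1ℚ + a) - (1ℚ + b)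
  shift-both = solve-∀ ℚ-ring

C-*-factorials : ∀ {n k} → k ℕ.≤ n → (n C k) ℕ.* (k ! ℕ.* (n ℕ.∸ k) !) ≡ n !
C-*-factorials {n} {k} k≤n =
  trans (cong (ℕ._* (k ! ℕ.* (n ℕ.∸ k) !)) (nCk≡n!/k![n-k]! k≤n))
        (m/n*n≡m {{ℕ._!*_!≢0 k (n ℕ.∸ k)}} (k![n∸k]!∣n! k≤n))

ι-C : ∀ n k → ι (n C k) ≡ ι (n !) * invFact k * invFactDiff n k
ι-C n k with k ℕ.≤? n
... | no k≰n = begin
  ι (n C k)                          ≡⟨ cong ι (k>n⇒nCk≡0 (ℕ.≰⇒> k≰n)) ⟩
  0ℚ                                 ≡⟨ sym (ℚ.*-zeroʳ (ι (n !) * invFact k)) ⟩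
  ι (n !) * invFact k * 0ℚ           ≡⟨ cong (ι (n !) * invFact k *_) (sym (invFactDiff-> (ℕ.≰⇒> k≰n))) ⟩
  ι (n !) * invFact k * invFactDiff n k ∎
... | yes k≤n = begin
  ι (n C k)                                              ≡⟨ sym (ℚ.*-identityʳ _) ⟩
  ι (n C k) * 1ℚ                                         ≡⟨ cong (ι (n C k) *_) (sym (cong₂ _*_ (!-invFact k) (!-invFact (n ℕ.∸ k)))) ⟩
  ι (n C k) * ((ι (k !) * invFact k) * (ι ((n ℕ.∸ k) !) * invFact (n ℕ.∸ k)))
                                                         ≡⟨ regroup (ι (n C k)) (ι (k !)) (ι ((n ℕ.∸ k) !)) (invFact k) (invFact (n ℕ.∸ k)) ⟩
  ι (n C k) * (ι (k !) * ι ((n ℕ.∸ k) !)) * invFact k * invFact (n ℕ.∸ k)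
                                                         ≡⟨ cong (λ x → x * invFact k * invFact (n ℕ.∸ k)) (sym (trans (ι-* (n C k) _) (cong (ι (n C k) *_) (ι-* (k !) _)))) ⟩
  ι ((n C k) ℕ.* (k ! ℕ.* (n ℕ.∸ k) !)) * invFact k * invFact (n ℕ.∸ k)
                                                         ≡⟨ cong (λ m → ι m * invFact k * invFact (n ℕ.∸ k)) (C-*-factorials k≤n) ⟩
  ι (n !) * invFact k * invFact (n ℕ.∸ k)                ≡⟨ cong (ι (n !) * invFact k *_) (sym (invFactDiff-≤ k≤n)) ⟩
  ι (n !) * invFact k * invFactDiff n k                  ∎
  where
  regroup : ∀ c f g i j → c * ((f * i) * (g * j)) ≡ c * (f * g) * i * j
  regroup = solve-∀ ℚ-ring

ι-C-complement : ∀ p k → ι ((p ℕ.+ k) C k) ≡ ι ((p ℕ.+ k) !) * invFact k * invFact p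
ι-C-complement p k = trans (ι-C (p ℕ.+ k) k) (cong (ι ((p ℕ.+ k) !) * invFact k *_) (invFactDiff-+ p k))

-- Polynomials as coefficient sequences

VanishesAbove : ℕ → (ℕ → ℚ) → Set
VanishesAbove n u = ∀ k → n < k → u k ≡ 0ℚ

shift : (ℕ → ℚ) → ℕ → ℚ
shift u zero = 0ℚ
shift u (suc k) = u k

shift-vanishes : ∀ {n u} → VanishesAbove n u → VanishesAbove (suc n) (shift u)
shift-vanishes v (suc k) (s≤s n<k) = v k n<k

vanishes-via-invFactDiff : ∀ {n u} (c : ℕ → ℚ) → (∀ k → u k ≡ c k * invFactDiff n k) → VanishesAbove n u
vanishes-via-invFactDiff c u≡ k n<k = trans (u≡ k) (trans (cong (c k *_) (invFactDiff-> n<k)) (ℚ.*-zeroʳ (c k)))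

sumTo-cong : ∀ n {f g : ℕ → ℚ} → (∀ k → f k ≡ g k) → sumTo n f ≡ sumTo n g
sumTo-cong zero f≗g = f≗g 0
sumTo-cong (suc n) f≗g = cong₂ _+_ (sumTo-cong n f≗g) (f≗g (suc n))

sumTo-+ : ∀ n (f g : ℕ → ℚ) → sumTo n f + sumTo n g ≡ sumTo n (λ k → f k + g k)
sumTo-+ zero f g = refl
sumTo-+ (suc n) f g = trans (interchange (sumTo n f) (f (suc n)) (sumTo n g) (g (suc n)))
                            (cong (_+ (f (suc n) + g (suc n))) (sumTo-+ n f g))
  where
  interchange : ∀ a b c d → a + b + (c + d) ≡ a + c + (b + d)
  interchange = solve-∀ ℚ-ring

sumTo-*ˡ : ∀ n c (f : ℕ → ℚ) → c * sumTo n f ≡ sumTo n (λ k → c * f k)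
sumTo-*ˡ zero c f = refl
sumTo-*ˡ (suc n) c f = trans (ℚ.*-distribˡ-+ c (sumTo n f) (f (suc n))) (cong (_+ c * f (suc n)) (sumTo-*ˡ n c f))

sumTo-zero : ∀ n → sumTo n (λ _ → 0ℚ) ≡ 0ℚ
sumTo-zero zero = refl
sumTo-zero (suc n) = trans (ℚ.+-identityʳ _) (sumTo-zero n)

sumTo-suc : ∀ n (f : ℕ → ℚ) → sumTo (suc n) f ≡ f 0 + sumTo n (λ k → f (suc k))
sumTo-suc zero f = refl
sumTo-suc (suc n) f = trans (cong (_+ f (suc (suc n))) (sumTo-suc n f)) (ℚ.+-assoc (f 0) _ _)

sumTo-pad : ∀ {n N} (f : ℕ → ℚ) → VanishesAbove n f → n ℕ.≤ N → sumTo N f ≡ sumTo n f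
sumTo-pad {n} f f-vanishes n≤N = pad (ℕ.≤⇒≤′ n≤N)
  where
  pad : ∀ {N} → n ℕ.≤′ N → sumTo N f ≡ sumTo n f
  pad ℕ.≤′-refl = refl
  pad {suc N} (ℕ.≤′-step n≤′N) = begin
    sumTo N f + f (suc N)    ≡⟨ cong₂ _+_ (pad n≤′N) (f-vanishes (suc N) (s≤s (ℕ.≤′⇒≤ n≤′N))) ⟩
    sumTo n f + 0ℚ           ≡⟨ ℚ.+-identityʳ (sumTo n f) ⟩
    sumTo n f                ∎

eval : ℕ → (ℕ → ℚ) → ℚ → ℚ
eval n u x = sumTo n (λ k → u k * (x ^' k))

eval-cong : ∀ n {u v} x → (∀ k → u k ≡ v k) → eval n u x ≡ eval n v x
eval-cong n x u≗v = sumTo-cong n (λ k → cong (_* (x ^' k)) (u≗v k))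

eval-+ : ∀ n u v x → eval n u x + eval n v x ≡ eval n (λ k → u k + v k) x
eval-+ n u v x = trans (sumTo-+ n _ _) (sumTo-cong n (λ k → sym (ℚ.*-distribʳ-+ (x ^' k) (u k) (v k))))

eval-*ˡ : ∀ n c u x → c * eval n u x ≡ eval n (λ k → c * u k) x
eval-*ˡ n c u x = trans (sumTo-*ˡ n c _) (sumTo-cong n (λ k → sym (ℚ.*-assoc c (u k) (x ^' k))))

eval-shift : ∀ n u x → x * eval n u x ≡ eval (suc n) (shift u) x
eval-shift n u x = begin
  x * eval n u x                                  ≡⟨ sumTo-*ˡ n x _ ⟩
  sumTo n (λ k → x * (u k * (x ^' k)))            ≡⟨ sumTo-cong n (λ k → swap x (u k) (x ^' k)) ⟩
  sumTo n (λ k → u k * (x ^' suc k))              ≡⟨ sym (ℚ.+-identityˡ _) ⟩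
  0ℚ + sumTo n (λ k → u k * (x ^' suc k))         ≡⟨ cong (_+ sumTo n (λ k → u k * (x ^' suc k))) (sym (ℚ.*-zeroˡ 1ℚ)) ⟩
  0ℚ * 1ℚ + sumTo n (λ k → u k * (x ^' suc k))    ≡⟨ sym (sumTo-suc n _) ⟩
  eval (suc n) (shift u) x                        ∎
  where
  swap : ∀ a b c → a * (b * c) ≡ b * (a * c)
  swap = solve-∀ ℚ-ring

eval-pad : ∀ {n N u} x → VanishesAbove n u → n ℕ.≤ N → eval N u x ≡ eval n u x
eval-pad x u-vanishes =
  sumTo-pad _ (λ k n<k → trans (cong (_* (x ^' k)) (u-vanishes k n<k)) (ℚ.*-zeroˡ (x ^' k)))

sgn-^' : ∀ k t → sgn k * (t ^' k) ≡ (- t) ^' k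
sgn-^' zero t = refl
sgn-^' (suc k) t = begin
  - sgn k * (t * (t ^' k))     ≡⟨ sign-swap (sgn k) t (t ^' k) ⟩
  - t * (sgn k * (t ^' k))     ≡⟨ cong (- t *_) (sgn-^' k t) ⟩
  - t * ((- t) ^' k)           ∎
  where
  sign-swap : ∀ s a b → - s * (a * b) ≡ - a * (s * b)
  sign-swap = solve-∀ ℚ-ring

alternating-eval : ∀ n u t → sumTo n (λ k → sgn k * (u k * (t ^' k))) ≡ eval n u (- t)
alternating-eval n u t = sumTo-cong n (λ k → trans (swap (sgn k) (u k) (t ^' k)) (cong (u k *_) (sgn-^' k t)))
  where
  swap : ∀ a b c → a * (b * c) ≡ b * (a * c)
  swap = solve-∀ ℚ-ring

horner : List ℚ → ℚ → ℚ
horner [] x = 0ℚ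
horner (p ∷ ps) x = p + x * horner ps x

infixl 7 _⋆_
_⋆_ : List ℚ → (ℕ → ℚ) → ℕ → ℚ
([] ⋆ u) k = 0ℚ
((p ∷ ps) ⋆ u) k = p * u k + (ps ⋆ shift u) k

eval-⋆ : ∀ ps {n N u} x → VanishesAbove n u → length ps ℕ.+ n ℕ.≤ N →
         horner ps x * eval n u x ≡ eval N (ps ⋆ u) x
eval-⋆ [] {n} {N} {u} x _ _ = begin
  0ℚ * eval n u x                 ≡⟨ ℚ.*-zeroˡ (eval n u x) ⟩
  0ℚ                              ≡⟨ sym (sumTo-zero N) ⟩
  sumTo N (λ _ → 0ℚ)              ≡⟨ sumTo-cong N (λ k → sym (ℚ.*-zeroˡ (x ^' k))) ⟩
  eval N ([] ⋆ u) x               ∎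
eval-⋆ (p ∷ ps) {n} {N} {u} x u-vanishes bound = begin
  (p + x * horner ps x) * eval n u x
    ≡⟨ distrib p x (horner ps x) (eval n u x) ⟩
  p * eval n u x + horner ps x * (x * eval n u x)
    ≡⟨ cong₂ (λ a b → p * a + horner ps x * b) (sym (eval-pad x u-vanishes n≤N)) (eval-shift n u x) ⟩
  p * eval N u x + horner ps x * eval (suc n) (shift u) x
    ≡⟨ cong₂ _+_ (eval-*ˡ N p u x) (eval-⋆ ps x (shift-vanishes u-vanishes) bound′) ⟩
  eval N (λ k → p * u k) x + eval N (ps ⋆ shift u) x
    ≡⟨ eval-+ N (λ k → p * u k) (ps ⋆ shift u) x ⟩
  eval N ((p ∷ ps) ⋆ u) x
    ∎
  where
  distrib : ∀ p x h e → (p + x * h) * e ≡ p * e + h * (x * e)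
  distrib = solve-∀ ℚ-ring
  bound′ : length ps ℕ.+ suc n ℕ.≤ N
  bound′ = ℕ.≤-trans (ℕ.≤-reflexive (ℕ.+-suc (length ps) n)) bound
  n≤N : n ℕ.≤ N
  n≤N = ℕ.≤-trans (ℕ.m≤n+m n (suc (length ps))) bound

eval-⋆-+ : ∀ ps {n N u r} x → VanishesAbove n u → length ps ℕ.+ n ℕ.≤ N →
           eval N (λ k → (ps ⋆ u) k + r k) x ≡ horner ps x * eval n u x + eval N r x
eval-⋆-+ ps {N = N} {u} {r} x u-vanishes bound =
  trans (sym (eval-+ N (ps ⋆ u) r x)) (cong (_+ eval N r x) (sym (eval-⋆ ps x u-vanishes bound)))

coefficients⇒eval₂ : ∀ {N n₀ n₁ n₂ u₀ u₁ u₂} p₀ p₁ p₂ x →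
        VanishesAbove n₀ u₀ → VanishesAbove n₁ u₁ → VanishesAbove n₂ u₂ →
        length p₀ ℕ.+ n₀ ℕ.≤ N → length p₁ ℕ.+ n₁ ℕ.≤ N → length p₂ ℕ.+ n₂ ℕ.≤ N →
        (∀ k → (p₀ ⋆ u₀) k ≡ (p₁ ⋆ u₁) k + (p₂ ⋆ u₂) k) →
        horner p₀ x * eval n₀ u₀ x ≡ horner p₁ x * eval n₁ u₁ x + horner p₂ x * eval n₂ u₂ x
coefficients⇒eval₂ {N} {n₀} {n₁} {n₂} {u₀} {u₁} {u₂} p₀ p₁ p₂ x v₀ v₁ v₂ b₀ b₁ b₂ coefficients = begin
  horner p₀ x * eval n₀ u₀ x                            ≡⟨ eval-⋆ p₀ x v₀ b₀ ⟩
  eval N (p₀ ⋆ u₀) x                                    ≡⟨ eval-cong N x coefficients ⟩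
  eval N (λ k → (p₁ ⋆ u₁) k + (p₂ ⋆ u₂) k) x            ≡⟨ eval-⋆-+ p₁ x v₁ b₁ ⟩
  horner p₁ x * eval n₁ u₁ x + eval N (p₂ ⋆ u₂) x       ≡⟨ cong (horner p₁ x * eval n₁ u₁ x +_) (sym (eval-⋆ p₂ x v₂ b₂)) ⟩
  horner p₁ x * eval n₁ u₁ x + horner p₂ x * eval n₂ u₂ x ∎

coefficients⇒eval₃ : ∀ {N n₀ n₁ n₂ n₃ u₀ u₁ u₂ u₃} p₀ p₁ p₂ p₃ x →
        VanishesAbove n₀ u₀ → VanishesAbove n₁ u₁ → VanishesAbove n₂ u₂ → VanishesAbove n₃ u₃ →
        length p₀ ℕ.+ n₀ ℕ.≤ N → length p₁ ℕ.+ n₁ ℕ.≤ N → length p₂ ℕ.+ n₂ ℕ.≤ N → length p₃ ℕ.+ n₃ ℕ.≤ N →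
        (∀ k → (p₀ ⋆ u₀) k ≡ (p₁ ⋆ u₁) k + ((p₂ ⋆ u₂) k + (p₃ ⋆ u₃) k)) →
        horner p₀ x * eval n₀ u₀ x
          ≡ horner p₁ x * eval n₁ u₁ x + (horner p₂ x * eval n₂ u₂ x + horner p₃ x * eval n₃ u₃ x)
coefficients⇒eval₃ {N} {n₀} {n₁} {n₂} {n₃} {u₀} {u₁} {u₂} {u₃} p₀ p₁ p₂ p₃ x v₀ v₁ v₂ v₃ b₀ b₁ b₂ b₃ coefficients = begin
  horner p₀ x * eval n₀ u₀ x                            ≡⟨ eval-⋆ p₀ x v₀ b₀ ⟩
  eval N (p₀ ⋆ u₀) x                                    ≡⟨ eval-cong N x coefficients ⟩
  eval N (λ k → (p₁ ⋆ u₁) k + ((p₂ ⋆ u₂) k + (p₃ ⋆ u₃) k)) x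
                                                        ≡⟨ eval-⋆-+ p₁ x v₁ b₁ ⟩
  horner p₁ x * eval n₁ u₁ x + eval N (λ k → (p₂ ⋆ u₂) k + (p₃ ⋆ u₃) k) x
                                                        ≡⟨ cong (horner p₁ x * eval n₁ u₁ x +_) (eval-⋆-+ p₂ x v₂ b₂) ⟩
  horner p₁ x * eval n₁ u₁ x + (horner p₂ x * eval n₂ u₂ x + eval N (p₃ ⋆ u₃) x)
                                                        ≡⟨ cong (λ z → horner p₁ x * eval n₁ u₁ x + (horner p₂ x * eval n₂ u₂ x + z)) (sym (eval-⋆ p₃ x v₃ b₃)) ⟩
  horner p₁ x * eval n₁ u₁ x + (horner p₂ x * eval n₂ u₂ x + horner p₃ x * eval n₃ u₃ x) ∎


+-interchange-≤ : ∀ d l n → d ℕ.+ (l ℕ.+ n) ℕ.≤ l ℕ.+ (d ℕ.+ n)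
+-interchange-≤ d l n = ℕ.≤-reflexive (interchange d l n)
  where
  interchange : ∀ d l n → d ℕ.+ (l ℕ.+ n) ≡ l ℕ.+ (d ℕ.+ n)
  interchange = solve-∀ ℕ-Solver.ring

+-comm-≤ : ∀ {d N} l → d ℕ.≤ N → d ℕ.+ l ℕ.≤ l ℕ.+ N
+-comm-≤ {d} l d≤N = ℕ.≤-trans (ℕ.≤-reflexive (ℕ.+-comm d l)) (ℕ.+-monoʳ-≤ l d≤N)

-- Type A

coeffA : ℕ → ℕ → ℚ
coeffA n k = q ((n C k) ℕ.* ((n ℕ.+ k) C suc k)) ÷' q n

coeffA-closed : ∀ p k → coeffA (suc p) k ≡ ι ((suc p ℕ.+ k) !) * (invFact k * invFact (suc k)) * invFactDiff (suc p) k
coeffA-closed p k = begin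
  coeffA n k
    ≡⟨ cong₂ _÷'_ (sym (ι≡q (c₁ ℕ.* c₂))) (sym (ι≡q n)) ⟩
  ι (c₁ ℕ.* c₂) ÷' ι n
    ≡⟨ cong (_÷' ι n) (ι-* c₁ c₂) ⟩
  (ι c₁ * ι c₂) ÷' ι n
    ≡⟨ cong (_÷' ι n) (cong₂ _*_ (ι-C n k) (trans (ι-C (n ℕ.+ k) (suc k)) (cong (F * invFact (suc k) *_) (invFactDiff-+ p k)))) ⟩
  ((ι (n !) * invFact k * invFactDiff n k) * (F * invFact (suc k) * invFact p)) ÷' ι n
    ≡⟨ cong (λ z → ((z * invFact k * invFactDiff n k) * (F * invFact (suc k) * invFact p)) ÷' ι n) (ι-!-suc p) ⟩
  ((ι n * ι (p !) * invFact k * invFactDiff n k) * (F * invFact (suc k) * invFact p)) ÷' ι n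
    ≡⟨ cong (_÷' ι n) (regroup (ι n) (ι (p !)) (invFact k) (invFactDiff n k) F (invFact (suc k)) (invFact p)) ⟩
  (ι n * X * (ι (p !) * invFact p)) ÷' ι n
    ≡⟨ cong (λ z → (ι n * X * z) ÷' ι n) (!-invFact p) ⟩
  (ι n * X * 1ℚ) ÷' ι n
    ≡⟨ cong (_÷' ι n) (ℚ.*-identityʳ (ι n * X)) ⟩
  (ι n * X) ÷' ι n
    ≡⟨ *-÷'-cancelʳ (ι n) X (ι≢0 n) ⟩
  X ∎
  where
  n = suc p
  c₁ = n C k
  c₂ = (n ℕ.+ k) C suc k
  F = ι ((n ℕ.+ k) !)
  X = F * (invFact k * invFact (suc k)) * invFactDiff n k
  regroup : ∀ a f i d F j g → a * f * i * d * (F * j * g) ≡ a * (F * (i * j) * d) * (f * g)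
  regroup = solve-∀ ℚ-ring

coeffA-vanishes : ∀ p → VanishesAbove (suc p) (coeffA (suc p))
coeffA-vanishes p = vanishes-via-invFactDiff (λ k → ι ((suc p ℕ.+ k) !) * (invFact k * invFact (suc k))) (coeffA-closed p)

-- The coefficients of t^k in the A-recurrence for l = suc p are polynomial multiples of this term.
baseA : ℕ → ℕ → ℚ
baseA p k = ι ((suc p ℕ.+ k) !) * (invFact k * invFact (suc k)) * invFactDiff (3 ℕ.+ p) k

coeffA-3+ : ∀ p k → coeffA (3 ℕ.+ p) k ≡ ι (3 ℕ.+ (p ℕ.+ k)) * ι (2 ℕ.+ (p ℕ.+ k)) * baseA p k
coeffA-3+ p k = begin
  coeffA (3 ℕ.+ p) k                                 ≡⟨ coeffA-closed (2 ℕ.+ p) k ⟩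
  ι ((2 ℕ.+ S) !) * R * D                            ≡⟨ cong (λ f → f * R * D) (ι-!-suc² S) ⟩
  ι (2 ℕ.+ S) * (ι (1 ℕ.+ S) * ι (S !)) * R * D      ≡⟨ regroup (ι (2 ℕ.+ S)) (ι (1 ℕ.+ S)) (ι (S !)) R D ⟩
  ι (2 ℕ.+ S) * ι (1 ℕ.+ S) * baseA p k              ∎
  where
  S = suc p ℕ.+ k
  R = invFact k * invFact (suc k)
  D = invFactDiff (3 ℕ.+ p) k
  regroup : ∀ a b F R D → a * (b * F) * R * D ≡ a * b * (F * R * D)
  regroup = solve-∀ ℚ-ring

coeffA-2+ : ∀ p k → coeffA (2 ℕ.+ p) k ≡ ι (2 ℕ.+ (p ℕ.+ k)) * (ι (3 ℕ.+ p) - ι k) * baseA p k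
coeffA-2+ p k = begin
  coeffA (2 ℕ.+ p) k                                 ≡⟨ coeffA-closed (1 ℕ.+ p) k ⟩
  ι ((1 ℕ.+ S) !) * R * invFactDiff (3 ℕ.+ p) (suc k)
                                                     ≡⟨ cong₂ (λ f d → f * R * d) (ι-!-suc S) (invFactDiff-suc (3 ℕ.+ p) k) ⟩
  ι (1 ℕ.+ S) * ι (S !) * R * (δ * D)                ≡⟨ regroup (ι (1 ℕ.+ S)) δ (ι (S !)) R D ⟩
  ι (1 ℕ.+ S) * δ * baseA p k                        ∎
  where
  S = suc p ℕ.+ k
  δ = ι (3 ℕ.+ p) - ι k
  R = invFact k * invFact (suc k)
  D = invFactDiff (3 ℕ.+ p) k
  regroup : ∀ a b F R D → a * F * R * (b * D) ≡ a * b * (F * R * D)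
  regroup = solve-∀ ℚ-ring

coeffA-1+ : ∀ p k → coeffA (1 ℕ.+ p) k ≡ (ι (3 ℕ.+ p) - ι (suc k)) * (ι (3 ℕ.+ p) - ι k) * baseA p k
coeffA-1+ p k = begin
  coeffA (1 ℕ.+ p) k                                 ≡⟨ coeffA-closed p k ⟩
  F * R * invFactDiff (3 ℕ.+ p) (2 ℕ.+ k)            ≡⟨ cong (F * R *_) (trans (invFactDiff-suc (3 ℕ.+ p) (suc k)) (cong (δ₁ *_) (invFactDiff-suc (3 ℕ.+ p) k))) ⟩
  F * R * (δ₁ * (δ₀ * D))                            ≡⟨ regroup δ₁ δ₀ F R D ⟩
  δ₁ * δ₀ * baseA p k                                ∎
  where
  δ₁ = ι (3 ℕ.+ p) - ι (suc k)
  δ₀ = ι (3 ℕ.+ p) - ι k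
  F = ι ((suc p ℕ.+ k) !)
  R = invFact k * invFact (suc k)
  D = invFactDiff (3 ℕ.+ p) k
  regroup : ∀ a b F R D → F * R * (a * (b * D)) ≡ a * b * (F * R * D)
  regroup = solve-∀ ℚ-ring

shift-coeffA-2+ : ∀ p k → shift (coeffA (2 ℕ.+ p)) k ≡ ι k * ι (suc k) * baseA p k
shift-coeffA-2+ p zero = sym (zero-left (ι 1) (baseA p 0))
  where
  zero-left : ∀ a b → ι 0 * a * b ≡ 0ℚ
  zero-left = solve-∀ ℚ-ring
shift-coeffA-2+ p (suc j) = begin
  coeffA (2 ℕ.+ p) j                                 ≡⟨ coeffA-closed (1 ℕ.+ p) j ⟩
  ι ((2 ℕ.+ (p ℕ.+ j)) !) * (invFact j * invFact (suc j)) * D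
                                                     ≡⟨ cong₂ (λ f r → f * r * D) (cong (λ n → ι (suc n !)) (sym (ℕ.+-suc p j))) (cong₂ _*_ (invFact-suc j) (invFact-suc (suc j))) ⟩
  F * (ι (suc j) * invFact (suc j) * (ι (2 ℕ.+ j) * invFact (2 ℕ.+ j))) * D
                                                     ≡⟨ regroup (ι (suc j)) (ι (2 ℕ.+ j)) F (invFact (suc j)) (invFact (2 ℕ.+ j)) D ⟩
  ι (suc j) * ι (2 ℕ.+ j) * baseA p (suc j)          ∎
  where
  F = ι ((suc p ℕ.+ suc j) !)
  D = invFactDiff (3 ℕ.+ p) (suc j)
  regroup : ∀ a b F i j D → F * (a * i * (b * j)) * D ≡ a * b * (F * (i * j) * D)
  regroup = solve-∀ ℚ-ring

-- The hypotheses replace each coefficient by its normal form (a polynomial times the common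
-- term B), after which the coefficientwise recurrence is a polynomial identity in P = ι p and K.
coeffA-recurrence-normalised : ∀ P K S B {c a d X₂ X₁ X₁′ X₀} →
  let L = 1ℚ + P
      L₂ = 1ℚ + (1ℚ + L)
      S₂ = 1ℚ + (1ℚ + S)
      S₃ = 1ℚ + S₂
      K₁ = 1ℚ + K
  in S ≡ P + K → c ≡ L + q 3 → a ≡ q 2 * L + q 3 → d ≡ L →
     X₂ ≡ S₃ * S₂ * B → X₁ ≡ S₂ * (L₂ - K) * B → X₁′ ≡ K * K₁ * B → X₀ ≡ (L₂ - K₁) * (L₂ - K) * B →
     c * X₂ + 0ℚ ≡ a * X₁ + (q 2 * a * X₁′ + 0ℚ) + (- d * X₀ + 0ℚ)
coeffA-recurrence-normalised P K S B refl refl refl refl refl refl refl refl = solve (P ∷ K ∷ B ∷ []) ℚ-ring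

coeffA-recurrence : ∀ l → 1 ≤ l → ∀ k →
  ((q (l ℕ.+ 3) ∷ []) ⋆ coeffA (l ℕ.+ 2)) k
    ≡ ((q (2 ℕ.* l ℕ.+ 3) ∷ q 2 * q (2 ℕ.* l ℕ.+ 3) ∷ []) ⋆ coeffA (l ℕ.+ 1)) k + ((- q l ∷ []) ⋆ coeffA l) k
coeffA-recurrence l@(suc p) (s≤s z≤n) k =
  coeffA-recurrence-normalised (ι p) (ι k) (ι (p ℕ.+ k)) (baseA p k)
    (ι-+ p k)
    (trans (sym (ι≡q (l ℕ.+ 3))) (ι-+ l 3))
    (q-linear 2 3 l)
    (sym (ι≡q l))
    (trans (cong (λ n → coeffA n k) (ℕ.+-comm l 2)) (coeffA-3+ p k))
    (trans (cong (λ n → coeffA n k) (ℕ.+-comm l 1)) (coeffA-2+ p k))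
    (trans (cong (λ n → shift (coeffA n) k) (ℕ.+-comm l 1)) (shift-coeffA-2+ p k))
    (coeffA-1+ p k)

A-recurrence : ∀ l → 1 ≤ l → ∀ t →
  q (l ℕ.+ 3) * NA (l ℕ.+ 2) t ≡ - (q (2 ℕ.* l ℕ.+ 3) * (q 2 * t - q 1) * NA (l ℕ.+ 1) t) - q l * NA l t
A-recurrence l@(suc p) l≥1 t = begin
  c * NA (l ℕ.+ 2) t
    ≡⟨ to-horner c x (NA (l ℕ.+ 2) t) ⟩
  horner p₂ x * NA (l ℕ.+ 2) t
    ≡⟨ cong (horner p₂ x *_) (alternating-eval (l ℕ.+ 2) (coeffA (l ℕ.+ 2)) t) ⟩
  horner p₂ x * eval (l ℕ.+ 2) (coeffA (l ℕ.+ 2)) x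
    ≡⟨ coefficients⇒eval₂ p₂ p₁ p₀ x (coeffA-vanishes (p ℕ.+ 2)) (coeffA-vanishes (p ℕ.+ 1)) (coeffA-vanishes p)
         (+-interchange-≤ 1 l 2) (+-interchange-≤ 2 l 1) (+-comm-≤ l (s≤s z≤n)) (coeffA-recurrence l l≥1) ⟩
  horner p₁ x * eval (l ℕ.+ 1) (coeffA (l ℕ.+ 1)) x + horner p₀ x * eval l (coeffA l) x
    ≡⟨ sym (cong₂ (λ X₁ X₀ → horner p₁ x * X₁ + horner p₀ x * X₀)
                  (alternating-eval (l ℕ.+ 1) (coeffA (l ℕ.+ 1)) t) (alternating-eval l (coeffA l) t)) ⟩
  horner p₁ x * NA (l ℕ.+ 1) t + horner p₀ x * NA l t
    ≡⟨ from-horner a (q l) t (NA (l ℕ.+ 1) t) (NA l t) ⟩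
  - (a * (q 2 * t - q 1) * NA (l ℕ.+ 1) t) - q l * NA l t ∎
  where
  x = - t
  c = q (l ℕ.+ 3)
  a = q (2 ℕ.* l ℕ.+ 3)
  p₂ = c ∷ []
  p₁ = a ∷ q 2 * a ∷ []
  p₀ = - q l ∷ []
  to-horner : ∀ c x E → c * E ≡ (c + x * 0ℚ) * E
  to-horner = solve-∀ ℚ-ring
  from-horner : ∀ a d t X₁ X₀ →
    (a + - t * (q 2 * a + - t * 0ℚ)) * X₁ + (- d + - t * 0ℚ) * X₀ ≡ - (a * (q 2 * t - q 1) * X₁) - d * X₀
  from-horner = solve-∀ ℚ-ring

-- Type B

coeffB : ℕ → ℕ → ℚ
coeffB n k = q ((n C k) ℕ.* ((n ℕ.+ k ℕ.∸ 1) C k))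

coeffB-closed : ∀ p k → coeffB (suc p) k ≡ ι (suc p) * ι ((p ℕ.+ k) !) * (invFact k * invFact k) * invFactDiff (suc p) k
coeffB-closed p k = begin
  coeffB n k
    ≡⟨ sym (ι≡q ((n C k) ℕ.* ((p ℕ.+ k) C k))) ⟩
  ι ((n C k) ℕ.* ((p ℕ.+ k) C k))
    ≡⟨ ι-* (n C k) ((p ℕ.+ k) C k) ⟩
  ι (n C k) * ι ((p ℕ.+ k) C k)
    ≡⟨ cong₂ _*_ (trans (ι-C n k) (cong (λ f → f * invFact k * invFactDiff n k) (ι-!-suc p))) (ι-C-complement p k) ⟩
  ι n * ι (p !) * invFact k * invFactDiff n k * (F * invFact k * invFact p)
    ≡⟨ regroup (ι n) (ι (p !)) (invFact k) (invFactDiff n k) F (invFact p) ⟩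
  ι n * F * (invFact k * invFact k) * invFactDiff n k * (ι (p !) * invFact p)
    ≡⟨ cong (ι n * F * (invFact k * invFact k) * invFactDiff n k *_) (!-invFact p) ⟩
  ι n * F * (invFact k * invFact k) * invFactDiff n k * 1ℚ
    ≡⟨ ℚ.*-identityʳ _ ⟩
  ι n * F * (invFact k * invFact k) * invFactDiff n k ∎
  where
  n = suc p
  F = ι ((p ℕ.+ k) !)
  regroup : ∀ a f i d F g → a * f * i * d * (F * i * g) ≡ a * F * (i * i) * d * (f * g)
  regroup = solve-∀ ℚ-ring

coeffB-vanishes : ∀ p → VanishesAbove (suc p) (coeffB (suc p))
coeffB-vanishes p = vanishes-via-invFactDiff (λ k → ι (suc p) * ι ((p ℕ.+ k) !) * (invFact k * invFact k)) (coeffB-closed p)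

-- The coefficients of t^k in the B-recurrence for l = suc p are polynomial multiples of this term.
baseB : ℕ → ℕ → ℚ
baseB p k = ι ((p ℕ.+ k) !) * (invFact k * invFact k) * invFactDiff (3 ℕ.+ p) k

coeffB-3+ : ∀ p k → coeffB (3 ℕ.+ p) k ≡ ι (3 ℕ.+ p) * (ι (2 ℕ.+ (p ℕ.+ k)) * ι (1 ℕ.+ (p ℕ.+ k))) * baseB p k
coeffB-3+ p k = begin
  coeffB (3 ℕ.+ p) k                                    ≡⟨ coeffB-closed (2 ℕ.+ p) k ⟩
  ι (3 ℕ.+ p) * ι ((2 ℕ.+ (p ℕ.+ k)) !) * R * D         ≡⟨ cong (λ f → ι (3 ℕ.+ p) * f * R * D) (ι-!-suc² (p ℕ.+ k)) ⟩
  ι (3 ℕ.+ p) * (a * (b * F)) * R * D                   ≡⟨ regroup (ι (3 ℕ.+ p)) a b F R D ⟩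
  ι (3 ℕ.+ p) * (a * b) * baseB p k                     ∎
  where
  a = ι (2 ℕ.+ (p ℕ.+ k))
  b = ι (1 ℕ.+ (p ℕ.+ k))
  F = ι ((p ℕ.+ k) !)
  R = invFact k * invFact k
  D = invFactDiff (3 ℕ.+ p) k
  regroup : ∀ c a b F R D → c * (a * (b * F)) * R * D ≡ c * (a * b) * (F * R * D)
  regroup = solve-∀ ℚ-ring

coeffB-2+ : ∀ p k → coeffB (2 ℕ.+ p) k ≡ ι (2 ℕ.+ p) * ι (1 ℕ.+ (p ℕ.+ k)) * (ι (3 ℕ.+ p) - ι k) * baseB p k
coeffB-2+ p k = begin
  coeffB (2 ℕ.+ p) k                                    ≡⟨ coeffB-closed (1 ℕ.+ p) k ⟩
  ι (2 ℕ.+ p) * ι ((1 ℕ.+ (p ℕ.+ k)) !) * R * invFactDiff (3 ℕ.+ p) (suc k)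
                                                        ≡⟨ cong₂ (λ f d → ι (2 ℕ.+ p) * f * R * d) (ι-!-suc (p ℕ.+ k)) (invFactDiff-suc (3 ℕ.+ p) k) ⟩
  ι (2 ℕ.+ p) * (b * F) * R * ((ι (3 ℕ.+ p) - ι k) * D) ≡⟨ regroup (ι (2 ℕ.+ p)) b (ι (3 ℕ.+ p) - ι k) F R D ⟩
  ι (2 ℕ.+ p) * b * (ι (3 ℕ.+ p) - ι k) * baseB p k     ∎
  where
  b = ι (1 ℕ.+ (p ℕ.+ k))
  F = ι ((p ℕ.+ k) !)
  R = invFact k * invFact k
  D = invFactDiff (3 ℕ.+ p) k
  regroup : ∀ c b d F R D → c * (b * F) * R * (d * D) ≡ c * b * d * (F * R * D)
  regroup = solve-∀ ℚ-ring

coeffB-1+ : ∀ p k → coeffB (1 ℕ.+ p) k ≡ ι (1 ℕ.+ p) * (ι (3 ℕ.+ p) - ι (suc k)) * (ι (3 ℕ.+ p) - ι k) * baseB p k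
coeffB-1+ p k = begin
  coeffB (1 ℕ.+ p) k                                    ≡⟨ coeffB-closed p k ⟩
  ι (1 ℕ.+ p) * F * R * invFactDiff (3 ℕ.+ p) (2 ℕ.+ k) ≡⟨ cong (ι (1 ℕ.+ p) * F * R *_) (invFactDiff-suc (3 ℕ.+ p) (suc k)) ⟩
  ι (1 ℕ.+ p) * F * R * (d₁ * invFactDiff (3 ℕ.+ p) (suc k))
                                                        ≡⟨ cong (λ z → ι (1 ℕ.+ p) * F * R * (d₁ * z)) (invFactDiff-suc (3 ℕ.+ p) k) ⟩
  ι (1 ℕ.+ p) * F * R * (d₁ * (d₀ * D))                 ≡⟨ regroup (ι (1 ℕ.+ p)) d₁ d₀ F R D ⟩
  ι (1 ℕ.+ p) * d₁ * d₀ * baseB p k                     ∎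
  where
  d₁ = ι (3 ℕ.+ p) - ι (suc k)
  d₀ = ι (3 ℕ.+ p) - ι k
  F = ι ((p ℕ.+ k) !)
  R = invFact k * invFact k
  D = invFactDiff (3 ℕ.+ p) k
  regroup : ∀ c a b F R D → c * F * R * (a * (b * D)) ≡ c * a * b * (F * R * D)
  regroup = solve-∀ ℚ-ring

shift-coeffB-2+ : ∀ p k → shift (coeffB (2 ℕ.+ p)) k ≡ ι (2 ℕ.+ p) * (ι k * ι k) * baseB p k
shift-coeffB-2+ p zero = sym (zero-middle (ι (2 ℕ.+ p)) (baseB p 0))
  where
  zero-middle : ∀ a b → a * (0ℚ * 0ℚ) * b ≡ 0ℚ
  zero-middle = solve-∀ ℚ-ring
shift-coeffB-2+ p (suc j) = begin
  coeffB (2 ℕ.+ p) j                                    ≡⟨ coeffB-closed (1 ℕ.+ p) j ⟩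
  ι (2 ℕ.+ p) * ι ((1 ℕ.+ (p ℕ.+ j)) !) * (invFact j * invFact j) * D
                                                        ≡⟨ cong₂ (λ f i → ι (2 ℕ.+ p) * f * (i * i) * D) (cong (λ n → ι (n !)) (sym (ℕ.+-suc p j))) (invFact-suc j) ⟩
  ι (2 ℕ.+ p) * F * ((a * i) * (a * i)) * D             ≡⟨ regroup (ι (2 ℕ.+ p)) a F i D ⟩
  ι (2 ℕ.+ p) * (a * a) * baseB p (suc j)               ∎
  where
  a = ι (suc j)
  i = invFact (suc j)
  F = ι ((p ℕ.+ suc j) !)
  D = invFactDiff (3 ℕ.+ p) (suc j)
  regroup : ∀ c a F i D → c * F * ((a * i) * (a * i)) * D ≡ c * (a * a) * (F * (i * i) * D)
  regroup = solve-∀ ℚ-ring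

coeffB-recurrence-normalised : ∀ P K S B {s c a E₁ E₀ X₂ X₁ X₁′ X₀} →
  let L = 1ℚ + P
      L₁ = 1ℚ + L
      L₂ = 1ℚ + L₁
      S₁ = 1ℚ + S
      S₂ = 1ℚ + S₁
      K₁ = 1ℚ + K
  in S ≡ P + K → s ≡ q 2 * L + 1ℚ → c ≡ L + q 2 → a ≡ q 2 * L + q 3 →
     E₁ ≡ q 2 * (q 2 * L * L + q 4 * L + 1ℚ) → E₀ ≡ L * (q 2 * L + q 3) →
     X₂ ≡ L₂ * (S₂ * S₁) * B → X₁ ≡ L₁ * S₁ * (L₂ - K) * B → X₁′ ≡ L₁ * (K * K) * B → X₀ ≡ L * (L₂ - K₁) * (L₂ - K) * B →
     s * c * X₂ + 0ℚ ≡ E₁ * X₁ + (q 2 * s * a * X₁′ + 0ℚ) + (- E₀ * X₀ + 0ℚ)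
coeffB-recurrence-normalised P K S B refl refl refl refl refl refl refl refl refl refl = solve (P ∷ K ∷ B ∷ []) ℚ-ring

coeffB-recurrence : ∀ l → 1 ≤ l → ∀ k →
  let s = q (2 ℕ.* l ℕ.+ 1)
      a = q (2 ℕ.* l ℕ.+ 3)
      γ = (q 2 * q (2 ℕ.* l ℕ.* l ℕ.+ 4 ℕ.* l ℕ.+ 1)) ÷' (s * a)
      δ = (q l * a) ÷' s
  in ((s * q (l ℕ.+ 2) ∷ []) ⋆ coeffB (l ℕ.+ 2)) k
       ≡ ((s * a * γ ∷ q 2 * s * a ∷ []) ⋆ coeffB (l ℕ.+ 1)) k + ((- (s * δ) ∷ []) ⋆ coeffB l) k
coeffB-recurrence l@(suc p) (s≤s z≤n) k =
  coeffB-recurrence-normalised (ι p) (ι k) (ι (p ℕ.+ k)) (baseB p k)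
    (ι-+ p k)
    (q-linear 2 1 l)
    (trans (sym (ι≡q (l ℕ.+ 2))) (ι-+ l 2))
    (q-linear 2 3 l)
    (trans (*-÷'-cancel (q (2 ℕ.* l ℕ.+ 1) * q (2 ℕ.* l ℕ.+ 3)) _ (*-≢0 (q-+suc≢0 (2 ℕ.* l) 0) (q-+suc≢0 (2 ℕ.* l) 2)))
           (cong (q 2 *_) (q-quadratic 2 4 1 l)))
    (trans (*-÷'-cancel (q (2 ℕ.* l ℕ.+ 1)) _ (q-+suc≢0 (2 ℕ.* l) 0))
           (cong₂ _*_ (sym (ι≡q l)) (q-linear 2 3 l)))
    (trans (cong (λ n → coeffB n k) (ℕ.+-comm l 2)) (coeffB-3+ p k))
    (trans (cong (λ n → coeffB n k) (ℕ.+-comm l 1)) (coeffB-2+ p k))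
    (trans (cong (λ n → shift (coeffB n) k) (ℕ.+-comm l 1)) (shift-coeffB-2+ p k))
    (coeffB-1+ p k)

B-recurrence : ∀ l → 1 ≤ l → ∀ t →
  q (l ℕ.+ 2) * NB (l ℕ.+ 2) t
    ≡ - (q (2 ℕ.* l ℕ.+ 3)
           * (q 2 * t - (q 2 * q (2 ℕ.* l ℕ.* l ℕ.+ 4 ℕ.* l ℕ.+ 1)) ÷' (q (2 ℕ.* l ℕ.+ 1) * q (2 ℕ.* l ℕ.+ 3)))
           * NB (l ℕ.+ 1) t)
      - ((q l * q (2 ℕ.* l ℕ.+ 3)) ÷' q (2 ℕ.* l ℕ.+ 1)) * NB l t
B-recurrence l@(suc p) l≥1 t = *-cancelˡ (q-+suc≢0 (2 ℕ.* l) 0) (begin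
  s * (c * NB (l ℕ.+ 2) t)
    ≡⟨ to-horner s c x (NB (l ℕ.+ 2) t) ⟩
  horner p₂ x * NB (l ℕ.+ 2) t
    ≡⟨ cong (horner p₂ x *_) (alternating-eval (l ℕ.+ 2) (coeffB (l ℕ.+ 2)) t) ⟩
  horner p₂ x * eval (l ℕ.+ 2) (coeffB (l ℕ.+ 2)) x
    ≡⟨ coefficients⇒eval₂ p₂ p₁ p₀ x (coeffB-vanishes (p ℕ.+ 2)) (coeffB-vanishes (p ℕ.+ 1)) (coeffB-vanishes p)
         (+-interchange-≤ 1 l 2) (+-interchange-≤ 2 l 1) (+-comm-≤ l (s≤s z≤n)) (coeffB-recurrence l l≥1) ⟩
  horner p₁ x * eval (l ℕ.+ 1) (coeffB (l ℕ.+ 1)) x + horner p₀ x * eval l (coeffB l) x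
    ≡⟨ sym (cong₂ (λ X₁ X₀ → horner p₁ x * X₁ + horner p₀ x * X₀) (alternating-eval (l ℕ.+ 1) (coeffB (l ℕ.+ 1)) t) (alternating-eval l (coeffB l) t)) ⟩
  horner p₁ x * NB (l ℕ.+ 1) t + horner p₀ x * NB l t
    ≡⟨ from-horner s a γ δ t (NB (l ℕ.+ 1) t) (NB l t) ⟩
  s * (- (a * (q 2 * t - γ) * NB (l ℕ.+ 1) t) - δ * NB l t) ∎)
  where
  x = - t
  s = q (2 ℕ.* l ℕ.+ 1)
  c = q (l ℕ.+ 2)
  a = q (2 ℕ.* l ℕ.+ 3)
  γ = (q 2 * q (2 ℕ.* l ℕ.* l ℕ.+ 4 ℕ.* l ℕ.+ 1)) ÷' (s * a)
  δ = (q l * a) ÷' s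
  p₂ = s * c ∷ []
  p₁ = s * a * γ ∷ q 2 * s * a ∷ []
  p₀ = - (s * δ) ∷ []
  to-horner : ∀ s c x E → s * (c * E) ≡ (s * c + x * 0ℚ) * E
  to-horner = solve-∀ ℚ-ring
  from-horner : ∀ s a γ δ t X₁ X₀ →
    (s * a * γ + - t * (q 2 * s * a + - t * 0ℚ)) * X₁ + (- (s * δ) + - t * 0ℚ) * X₀ ≡ s * (- (a * (q 2 * t - γ) * X₁) - δ * X₀)
  from-horner = solve-∀ ℚ-ring

-- Type D

coeffD : ℕ → ℕ → ℚ
coeffD n k = q ((n C k) ℕ.* ((n ℕ.+ k ℕ.∸ 2) C k) ℕ.+ binomShift2 n k ℕ.* ((n ℕ.+ k ℕ.∸ 3) C k))

ι-binomShift2 : ∀ r k → ι (binomShift2 (3 ℕ.+ r) k) ≡ ι ((1 ℕ.+ r) !) * (ι k * (ι k - 1ℚ)) * invFact k * invFactDiff (3 ℕ.+ r) k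
ι-binomShift2 r zero = sym (vanish₀ (ι ((1 ℕ.+ r) !)) (invFact 0) (invFactDiff (3 ℕ.+ r) 0))
  where
  vanish₀ : ∀ a b c → a * (0ℚ * (0ℚ - 1ℚ)) * b * c ≡ 0ℚ
  vanish₀ = solve-∀ ℚ-ring
ι-binomShift2 r (suc zero) = sym (vanish₁ (ι ((1 ℕ.+ r) !)) (invFact 1) (invFactDiff (3 ℕ.+ r) 1))
  where
  vanish₁ : ∀ a b c → a * ((1ℚ + 0ℚ) * ((1ℚ + 0ℚ) - 1ℚ)) * b * c ≡ 0ℚ
  vanish₁ = solve-∀ ℚ-ring
ι-binomShift2 r (suc (suc j)) = begin
  ι ((1 ℕ.+ r) C j)                                     ≡⟨ ι-C (1 ℕ.+ r) j ⟩
  G * invFact j * D                                     ≡⟨ cong (λ i → G * i * D) (trans (invFact-suc j) (cong (ι (suc j) *_) (invFact-suc (suc j)))) ⟩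
  G * (ι (suc j) * (ι (2 ℕ.+ j) * invFact (2 ℕ.+ j))) * D ≡⟨ regroup G (ι (suc j)) (invFact (2 ℕ.+ j)) D ⟩
  G * (ι (2 ℕ.+ j) * (ι (2 ℕ.+ j) - 1ℚ)) * invFact (2 ℕ.+ j) * D ∎
  where
  G = ι ((1 ℕ.+ r) !)
  D = invFactDiff (3 ℕ.+ r) (2 ℕ.+ j)
  regroup : ∀ a x i D → a * (x * ((1ℚ + x) * i)) * D ≡ a * ((1ℚ + x) * ((1ℚ + x) - 1ℚ)) * i * D
  regroup = solve-∀ ℚ-ring

ι-C-product : ∀ r k →
  ι ((3 ℕ.+ r) C k) * ι ((1 ℕ.+ (r ℕ.+ k)) C k)
    ≡ ι (3 ℕ.+ r) * ι (2 ℕ.+ r) * ι (1 ℕ.+ (r ℕ.+ k)) * (ι ((r ℕ.+ k) !) * (invFact k * invFact k) * invFactDiff (3 ℕ.+ r) k)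
ι-C-product r k = begin
  ι ((3 ℕ.+ r) C k) * ι ((1 ℕ.+ (r ℕ.+ k)) C k)
    ≡⟨ cong₂ _*_ (ι-C (3 ℕ.+ r) k) (ι-C-complement (1 ℕ.+ r) k) ⟩
  ι ((3 ℕ.+ r) !) * i * D * (ι ((1 ℕ.+ (r ℕ.+ k)) !) * i * h)
    ≡⟨ cong₂ (λ a b → a * i * D * (b * i * h)) (ι-!-suc² (1 ℕ.+ r)) (ι-!-suc (r ℕ.+ k)) ⟩
  ι (3 ℕ.+ r) * (ι (2 ℕ.+ r) * G) * i * D * (ι (1 ℕ.+ (r ℕ.+ k)) * F * i * h)
    ≡⟨ regroup (ι (3 ℕ.+ r)) (ι (2 ℕ.+ r)) (ι (1 ℕ.+ (r ℕ.+ k))) G h F i D ⟩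
  ι (3 ℕ.+ r) * ι (2 ℕ.+ r) * ι (1 ℕ.+ (r ℕ.+ k)) * (G * h) * (F * (i * i) * D)
    ≡⟨ cong (λ z → ι (3 ℕ.+ r) * ι (2 ℕ.+ r) * ι (1 ℕ.+ (r ℕ.+ k)) * z * (F * (i * i) * D)) (!-invFact (1 ℕ.+ r)) ⟩
  ι (3 ℕ.+ r) * ι (2 ℕ.+ r) * ι (1 ℕ.+ (r ℕ.+ k)) * 1ℚ * (F * (i * i) * D)
    ≡⟨ cong (_* (F * (i * i) * D)) (ℚ.*-identityʳ (ι (3 ℕ.+ r) * ι (2 ℕ.+ r) * ι (1 ℕ.+ (r ℕ.+ k)))) ⟩
  ι (3 ℕ.+ r) * ι (2 ℕ.+ r) * ι (1 ℕ.+ (r ℕ.+ k)) * (F * (i * i) * D) ∎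
  where
  i = invFact k
  h = invFact (1 ℕ.+ r)
  D = invFactDiff (3 ℕ.+ r) k
  F = ι ((r ℕ.+ k) !)
  G = ι ((1 ℕ.+ r) !)
  regroup : ∀ a b c G h F i D → a * (b * G) * i * D * (c * F * i * h) ≡ a * b * c * (G * h) * (F * (i * i) * D)
  regroup = solve-∀ ℚ-ring

ι-binomShift2-product : ∀ r k →
  ι (binomShift2 (3 ℕ.+ r) k) * ι ((r ℕ.+ k) C k)
    ≡ ι (1 ℕ.+ r) * (ι k * (ι k - 1ℚ)) * (ι ((r ℕ.+ k) !) * (invFact k * invFact k) * invFactDiff (3 ℕ.+ r) k)
ι-binomShift2-product r k = begin
  ι (binomShift2 (3 ℕ.+ r) k) * ι ((r ℕ.+ k) C k)
    ≡⟨ cong₂ _*_ (ι-binomShift2 r k) (ι-C-complement r k) ⟩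
  ι ((1 ℕ.+ r) !) * κ * i * D * (F * i * h)
    ≡⟨ cong (λ g → g * κ * i * D * (F * i * h)) (ι-!-suc r) ⟩
  ι (1 ℕ.+ r) * G * κ * i * D * (F * i * h)
    ≡⟨ regroup (ι (1 ℕ.+ r)) κ G h F i D ⟩
  ι (1 ℕ.+ r) * κ * (G * h) * (F * (i * i) * D)
    ≡⟨ cong (λ z → ι (1 ℕ.+ r) * κ * z * (F * (i * i) * D)) (!-invFact r) ⟩
  ι (1 ℕ.+ r) * κ * 1ℚ * (F * (i * i) * D)
    ≡⟨ cong (_* (F * (i * i) * D)) (ℚ.*-identityʳ (ι (1 ℕ.+ r) * κ)) ⟩
  ι (1 ℕ.+ r) * κ * (F * (i * i) * D) ∎
  where
  κ = ι k * (ι k - 1ℚ)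
  i = invFact k
  h = invFact r
  D = invFactDiff (3 ℕ.+ r) k
  F = ι ((r ℕ.+ k) !)
  G = ι (r !)
  regroup : ∀ c κ G h F i D → c * G * κ * i * D * (F * i * h) ≡ c * κ * (G * h) * (F * (i * i) * D)
  regroup = solve-∀ ℚ-ring

coeffD-closed : ∀ r k →
  coeffD (3 ℕ.+ r) k
    ≡ (ι (3 ℕ.+ r) * ι (2 ℕ.+ r) * ι (1 ℕ.+ (r ℕ.+ k)) + ι (1 ℕ.+ r) * (ι k * (ι k - 1ℚ)))
      * ι ((r ℕ.+ k) !) * (invFact k * invFact k) * invFactDiff (3 ℕ.+ r) k
coeffD-closed r k = begin
  coeffD (3 ℕ.+ r) k
    ≡⟨ sym (ι≡q (c₁ ℕ.* c₂ ℕ.+ c₃ ℕ.* c₄)) ⟩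
  ι (c₁ ℕ.* c₂ ℕ.+ c₃ ℕ.* c₄)
    ≡⟨ trans (ι-+ (c₁ ℕ.* c₂) (c₃ ℕ.* c₄)) (cong₂ _+_ (ι-* c₁ c₂) (ι-* c₃ c₄)) ⟩
  ι c₁ * ι c₂ + ι c₃ * ι c₄
    ≡⟨ cong₂ _+_ (ι-C-product r k) (ι-binomShift2-product r k) ⟩
  a * H + b * H
    ≡⟨ factor a b F R D ⟩
  (a + b) * F * R * D ∎
  where
  c₁ = (3 ℕ.+ r) C k
  c₂ = (1 ℕ.+ (r ℕ.+ k)) C k
  c₃ = binomShift2 (3 ℕ.+ r) k
  c₄ = (r ℕ.+ k) C k
  a = ι (3 ℕ.+ r) * ι (2 ℕ.+ r) * ι (1 ℕ.+ (r ℕ.+ k))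
  b = ι (1 ℕ.+ r) * (ι k * (ι k - 1ℚ))
  F = ι ((r ℕ.+ k) !)
  R = invFact k * invFact k
  D = invFactDiff (3 ℕ.+ r) k
  H = F * R * D
  factor : ∀ a b F R D → a * (F * R * D) + b * (F * R * D) ≡ (a + b) * F * R * D
  factor = solve-∀ ℚ-ring

coeffD-vanishes : ∀ r → VanishesAbove (3 ℕ.+ r) (coeffD (3 ℕ.+ r))
coeffD-vanishes r = vanishes-via-invFactDiff
  (λ k → (ι (3 ℕ.+ r) * ι (2 ℕ.+ r) * ι (1 ℕ.+ (r ℕ.+ k)) + ι (1 ℕ.+ r) * (ι k * (ι k - 1ℚ))) * ι ((r ℕ.+ k) !) * (invFact k * invFact k))
  (coeffD-closed r)

-- The coefficients of t^k in the D-recurrence for l = 4 + m are polynomial multiples of this term.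
baseD : ℕ → ℕ → ℚ
baseD m k = ι ((m ℕ.+ k) !) * (invFact k * invFact k) * invFactDiff (7 ℕ.+ m) k

coeffD-7+ : ∀ m k → let X = m ℕ.+ k in
  coeffD (7 ℕ.+ m) k
    ≡ (ι (7 ℕ.+ m) * ι (6 ℕ.+ m) * ι (5 ℕ.+ X) + ι (5 ℕ.+ m) * (ι k * (ι k - 1ℚ)))
      * (ι (4 ℕ.+ X) * (ι (3 ℕ.+ X) * (ι (2 ℕ.+ X) * ι (1 ℕ.+ X)))) * baseD m k
coeffD-7+ m k = begin
  coeffD (7 ℕ.+ m) k                                  ≡⟨ coeffD-closed (4 ℕ.+ m) k ⟩
  p * ι ((4 ℕ.+ X) !) * R * D                         ≡⟨ cong (λ f → p * f * R * D) (trans (ι-!-suc² (2 ℕ.+ X)) (cong (λ g → ι (4 ℕ.+ X) * (ι (3 ℕ.+ X) * g)) (ι-!-suc² X))) ⟩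
  p * (ι (4 ℕ.+ X) * (ι (3 ℕ.+ X) * (ι (2 ℕ.+ X) * (ι (1 ℕ.+ X) * F)))) * R * D
                                                      ≡⟨ regroup p (ι (4 ℕ.+ X)) (ι (3 ℕ.+ X)) (ι (2 ℕ.+ X)) (ι (1 ℕ.+ X)) F R D ⟩
  p * (ι (4 ℕ.+ X) * (ι (3 ℕ.+ X) * (ι (2 ℕ.+ X) * ι (1 ℕ.+ X)))) * baseD m k ∎
  where
  X = m ℕ.+ k
  p = ι (7 ℕ.+ m) * ι (6 ℕ.+ m) * ι (5 ℕ.+ X) + ι (5 ℕ.+ m) * (ι k * (ι k - 1ℚ))
  F = ι (X !)
  R = invFact k * invFact k
  D = invFactDiff (7 ℕ.+ m) k
  regroup : ∀ p a b c d F R D → p * (a * (b * (c * (d * F)))) * R * D ≡ p * (a * (b * (c * d))) * (F * R * D)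
  regroup = solve-∀ ℚ-ring

coeffD-6+ : ∀ m k → let X = m ℕ.+ k in
  coeffD (6 ℕ.+ m) k
    ≡ (ι (6 ℕ.+ m) * ι (5 ℕ.+ m) * ι (4 ℕ.+ X) + ι (4 ℕ.+ m) * (ι k * (ι k - 1ℚ)))
      * (ι (3 ℕ.+ X) * (ι (2 ℕ.+ X) * ι (1 ℕ.+ X))) * (ι (7 ℕ.+ m) - ι k) * baseD m k
coeffD-6+ m k = begin
  coeffD (6 ℕ.+ m) k                                  ≡⟨ coeffD-closed (3 ℕ.+ m) k ⟩
  p * ι ((3 ℕ.+ X) !) * R * invFactDiff (7 ℕ.+ m) (suc k)
                                                      ≡⟨ cong₂ (λ f d → p * f * R * d) (trans (ι-!-suc² (1 ℕ.+ X)) (cong (λ g → ι (3 ℕ.+ X) * (ι (2 ℕ.+ X) * g)) (ι-!-suc X))) (invFactDiff-suc (7 ℕ.+ m) k) ⟩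
  p * (ι (3 ℕ.+ X) * (ι (2 ℕ.+ X) * (ι (1 ℕ.+ X) * F))) * R * (δ * D)
                                                      ≡⟨ regroup p (ι (3 ℕ.+ X)) (ι (2 ℕ.+ X)) (ι (1 ℕ.+ X)) δ F R D ⟩
  p * (ι (3 ℕ.+ X) * (ι (2 ℕ.+ X) * ι (1 ℕ.+ X))) * δ * baseD m k ∎
  where
  X = m ℕ.+ k
  p = ι (6 ℕ.+ m) * ι (5 ℕ.+ m) * ι (4 ℕ.+ X) + ι (4 ℕ.+ m) * (ι k * (ι k - 1ℚ))
  δ = ι (7 ℕ.+ m) - ι k
  F = ι (X !)
  R = invFact k * invFact k
  D = invFactDiff (7 ℕ.+ m) k
  regroup : ∀ p a b c δ F R D → p * (a * (b * (c * F))) * R * (δ * D) ≡ p * (a * (b * c)) * δ * (F * R * D)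
  regroup = solve-∀ ℚ-ring

coeffD-5+ : ∀ m k → let X = m ℕ.+ k in
  coeffD (5 ℕ.+ m) k
    ≡ (ι (5 ℕ.+ m) * ι (4 ℕ.+ m) * ι (3 ℕ.+ X) + ι (3 ℕ.+ m) * (ι k * (ι k - 1ℚ)))
      * (ι (2 ℕ.+ X) * ι (1 ℕ.+ X)) * ((ι (7 ℕ.+ m) - ι (suc k)) * (ι (7 ℕ.+ m) - ι k)) * baseD m k
coeffD-5+ m k = begin
  coeffD (5 ℕ.+ m) k                                  ≡⟨ coeffD-closed (2 ℕ.+ m) k ⟩
  p * ι ((2 ℕ.+ X) !) * R * invFactDiff (7 ℕ.+ m) (2 ℕ.+ k)
                                                      ≡⟨ cong₂ (λ f d → p * f * R * d) (ι-!-suc² X) (trans (invFactDiff-suc (7 ℕ.+ m) (suc k)) (cong (δ₁ *_) (invFactDiff-suc (7 ℕ.+ m) k))) ⟩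
  p * (ι (2 ℕ.+ X) * (ι (1 ℕ.+ X) * F)) * R * (δ₁ * (δ₀ * D))
                                                      ≡⟨ regroup p (ι (2 ℕ.+ X)) (ι (1 ℕ.+ X)) δ₁ δ₀ F R D ⟩
  p * (ι (2 ℕ.+ X) * ι (1 ℕ.+ X)) * (δ₁ * δ₀) * baseD m k ∎
  where
  X = m ℕ.+ k
  p = ι (5 ℕ.+ m) * ι (4 ℕ.+ m) * ι (3 ℕ.+ X) + ι (3 ℕ.+ m) * (ι k * (ι k - 1ℚ))
  δ₁ = ι (7 ℕ.+ m) - ι (suc k)
  δ₀ = ι (7 ℕ.+ m) - ι k
  F = ι (X !)
  R = invFact k * invFact k
  D = invFactDiff (7 ℕ.+ m) k
  regroup : ∀ p a b δ₁ δ₀ F R D → p * (a * (b * F)) * R * (δ₁ * (δ₀ * D)) ≡ p * (a * b) * (δ₁ * δ₀) * (F * R * D)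
  regroup = solve-∀ ℚ-ring

coeffD-4+ : ∀ m k → let X = m ℕ.+ k in
  coeffD (4 ℕ.+ m) k
    ≡ (ι (4 ℕ.+ m) * ι (3 ℕ.+ m) * ι (2 ℕ.+ X) + ι (2 ℕ.+ m) * (ι k * (ι k - 1ℚ)))
      * ι (1 ℕ.+ X) * ((ι (7 ℕ.+ m) - ι (2 ℕ.+ k)) * ((ι (7 ℕ.+ m) - ι (suc k)) * (ι (7 ℕ.+ m) - ι k))) * baseD m k
coeffD-4+ m k = begin
  coeffD (4 ℕ.+ m) k                                  ≡⟨ coeffD-closed (1 ℕ.+ m) k ⟩
  p * ι ((1 ℕ.+ X) !) * R * invFactDiff (7 ℕ.+ m) (3 ℕ.+ k)
                                                      ≡⟨ cong₂ (λ f d → p * f * R * d) (ι-!-suc X)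
                                                           (trans (invFactDiff-suc (7 ℕ.+ m) (2 ℕ.+ k)) (cong (δ₂ *_) (trans (invFactDiff-suc (7 ℕ.+ m) (suc k)) (cong (δ₁ *_) (invFactDiff-suc (7 ℕ.+ m) k))))) ⟩
  p * (ι (1 ℕ.+ X) * F) * R * (δ₂ * (δ₁ * (δ₀ * D)))
                                                      ≡⟨ regroup p (ι (1 ℕ.+ X)) δ₂ δ₁ δ₀ F R D ⟩
  p * ι (1 ℕ.+ X) * (δ₂ * (δ₁ * δ₀)) * baseD m k ∎
  where
  X = m ℕ.+ k
  p = ι (4 ℕ.+ m) * ι (3 ℕ.+ m) * ι (2 ℕ.+ X) + ι (2 ℕ.+ m) * (ι k * (ι k - 1ℚ))
  δ₂ = ι (7 ℕ.+ m) - ι (2 ℕ.+ k)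
  δ₁ = ι (7 ℕ.+ m) - ι (suc k)
  δ₀ = ι (7 ℕ.+ m) - ι k
  F = ι (X !)
  R = invFact k * invFact k
  D = invFactDiff (7 ℕ.+ m) k
  regroup : ∀ p a δ₂ δ₁ δ₀ F R D → p * (a * F) * R * (δ₂ * (δ₁ * (δ₀ * D))) ≡ p * a * (δ₂ * (δ₁ * δ₀)) * (F * R * D)
  regroup = solve-∀ ℚ-ring


zero-square-factor : ∀ a b → a * (ι 0 * ι 0) * b ≡ 0ℚ
zero-square-factor = solve-∀ ℚ-ring

shift-coeffD-6+ : ∀ m k → let X = m ℕ.+ k in
  shift (coeffD (6 ℕ.+ m)) k
    ≡ (ι (6 ℕ.+ m) * ι (5 ℕ.+ m) * ι (3 ℕ.+ X) + ι (4 ℕ.+ m) * ((ι k - 1ℚ) * (ι k - q 2)))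
      * (ι (2 ℕ.+ X) * ι (1 ℕ.+ X)) * (ι k * ι k) * baseD m k
shift-coeffD-6+ m zero =
  sym (zero-square-factor ((ι (6 ℕ.+ m) * ι (5 ℕ.+ m) * ι (3 ℕ.+ (m ℕ.+ 0)) + ι (4 ℕ.+ m) * ((ι 0 - 1ℚ) * (ι 0 - q 2))) * (ι (2 ℕ.+ (m ℕ.+ 0)) * ι (1 ℕ.+ (m ℕ.+ 0)))) (baseD m 0))
shift-coeffD-6+ m (suc j) = begin
  coeffD (6 ℕ.+ m) j                                  ≡⟨ coeffD-closed (3 ℕ.+ m) j ⟩
  p * ι ((3 ℕ.+ Y) !) * (invFact j * invFact j) * D   ≡⟨ cong₂ (λ f i → p * f * (i * i) * D) (ι-!-suc² (suc Y)) (invFact-suc j) ⟩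
  p * (ι (3 ℕ.+ Y) * (ι (2 ℕ.+ Y) * F)) * ((ι (suc j) * i) * (ι (suc j) * i)) * D
                                                      ≡⟨ regroup (ι (6 ℕ.+ m)) (ι (5 ℕ.+ m)) (ι (4 ℕ.+ m)) (ι j) F i D (ι Y) (cong ι (ℕ.+-suc m j)) (cong (λ n → ι (n !)) (ℕ.+-suc m j)) ⟩
  (ι (6 ℕ.+ m) * ι (5 ℕ.+ m) * ι (3 ℕ.+ X) + ι (4 ℕ.+ m) * ((ι (suc j) - 1ℚ) * (ι (suc j) - q 2)))
    * (ι (2 ℕ.+ X) * ι (1 ℕ.+ X)) * (ι (suc j) * ι (suc j)) * baseD m (suc j) ∎
  where
  X = m ℕ.+ suc j
  Y = m ℕ.+ j
  p = ι (6 ℕ.+ m) * ι (5 ℕ.+ m) * ι (4 ℕ.+ Y) + ι (4 ℕ.+ m) * (ι j * (ι j - 1ℚ))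
  F = ι (suc Y !)
  i = invFact (suc j)
  D = invFactDiff (7 ℕ.+ m) (suc j)
  regroup : ∀ c₆ c₅ c₄ J F i D τ {σ F′} → σ ≡ 1ℚ + τ → F′ ≡ F →
    (c₆ * c₅ * (1ℚ + (1ℚ + (1ℚ + (1ℚ + τ)))) + c₄ * (J * (J - 1ℚ)))
      * ((1ℚ + (1ℚ + (1ℚ + τ))) * ((1ℚ + (1ℚ + τ)) * F)) * (((1ℚ + J) * i) * ((1ℚ + J) * i)) * D
    ≡ (c₆ * c₅ * (1ℚ + (1ℚ + (1ℚ + σ))) + c₄ * (((1ℚ + J) - 1ℚ) * ((1ℚ + J) - q 2)))
      * ((1ℚ + (1ℚ + σ)) * (1ℚ + σ)) * ((1ℚ + J) * (1ℚ + J)) * (F′ * (i * i) * D)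
  regroup c₆ c₅ c₄ J F i D τ refl refl = solve (c₆ ∷ c₅ ∷ c₄ ∷ J ∷ F ∷ i ∷ D ∷ τ ∷ []) ℚ-ring

shift-coeffD-5+ : ∀ m k → let X = m ℕ.+ k in
  shift (coeffD (5 ℕ.+ m)) k
    ≡ (ι (5 ℕ.+ m) * ι (4 ℕ.+ m) * ι (2 ℕ.+ X) + ι (3 ℕ.+ m) * ((ι k - 1ℚ) * (ι k - q 2)))
      * ι (1 ℕ.+ X) * (ι (7 ℕ.+ m) - ι k) * (ι k * ι k) * baseD m k
shift-coeffD-5+ m zero =
  sym (zero-square-factor ((ι (5 ℕ.+ m) * ι (4 ℕ.+ m) * ι (2 ℕ.+ (m ℕ.+ 0)) + ι (3 ℕ.+ m) * ((ι 0 - 1ℚ) * (ι 0 - q 2))) * ι (1 ℕ.+ (m ℕ.+ 0)) * (ι (7 ℕ.+ m) - ι 0)) (baseD m 0))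
shift-coeffD-5+ m (suc j) = begin
  coeffD (5 ℕ.+ m) j                                  ≡⟨ coeffD-closed (2 ℕ.+ m) j ⟩
  p * ι ((2 ℕ.+ Y) !) * (invFact j * invFact j) * invFactDiff (7 ℕ.+ m) (2 ℕ.+ j)
                                                      ≡⟨ cong₂ (λ f i → p * f * (i * i) * invFactDiff (7 ℕ.+ m) (2 ℕ.+ j)) (ι-!-suc (suc Y)) (invFact-suc j) ⟩
  p * (ι (2 ℕ.+ Y) * F) * ((ι (suc j) * i) * (ι (suc j) * i)) * invFactDiff (7 ℕ.+ m) (2 ℕ.+ j)
                                                      ≡⟨ cong (λ d → p * (ι (2 ℕ.+ Y) * F) * ((ι (suc j) * i) * (ι (suc j) * i)) * d) (invFactDiff-suc (7 ℕ.+ m) (suc j)) ⟩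
  p * (ι (2 ℕ.+ Y) * F) * ((ι (suc j) * i) * (ι (suc j) * i)) * (δ * D)
                                                      ≡⟨ regroup (ι (5 ℕ.+ m)) (ι (4 ℕ.+ m)) (ι (3 ℕ.+ m)) (ι j) F i δ D (ι Y) (cong ι (ℕ.+-suc m j)) (cong (λ n → ι (n !)) (ℕ.+-suc m j)) ⟩
  (ι (5 ℕ.+ m) * ι (4 ℕ.+ m) * ι (2 ℕ.+ X) + ι (3 ℕ.+ m) * ((ι (suc j) - 1ℚ) * (ι (suc j) - q 2)))
    * ι (1 ℕ.+ X) * δ * (ι (suc j) * ι (suc j)) * baseD m (suc j) ∎
  where
  X = m ℕ.+ suc j
  Y = m ℕ.+ j
  p = ι (5 ℕ.+ m) * ι (4 ℕ.+ m) * ι (3 ℕ.+ Y) + ι (3 ℕ.+ m) * (ι j * (ι j - 1ℚ))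
  δ = ι (7 ℕ.+ m) - ι (suc j)
  F = ι (suc Y !)
  i = invFact (suc j)
  D = invFactDiff (7 ℕ.+ m) (suc j)
  regroup : ∀ c₅ c₄ c₃ J F i δ D τ {σ F′} → σ ≡ 1ℚ + τ → F′ ≡ F →
    (c₅ * c₄ * (1ℚ + (1ℚ + (1ℚ + τ))) + c₃ * (J * (J - 1ℚ)))
      * ((1ℚ + (1ℚ + τ)) * F) * (((1ℚ + J) * i) * ((1ℚ + J) * i)) * (δ * D)
    ≡ (c₅ * c₄ * (1ℚ + (1ℚ + σ)) + c₃ * (((1ℚ + J) - 1ℚ) * ((1ℚ + J) - q 2)))
      * (1ℚ + σ) * δ * ((1ℚ + J) * (1ℚ + J)) * (F′ * (i * i) * D)
  regroup c₅ c₄ c₃ J F i δ D τ refl refl = solve (c₅ ∷ c₄ ∷ c₃ ∷ J ∷ F ∷ i ∷ δ ∷ D ∷ τ ∷ []) ℚ-ring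

shift-coeffD-4+ : ∀ m k → let X = m ℕ.+ k in
  shift (coeffD (4 ℕ.+ m)) k
    ≡ (ι (4 ℕ.+ m) * ι (3 ℕ.+ m) * ι (1 ℕ.+ X) + ι (2 ℕ.+ m) * ((ι k - 1ℚ) * (ι k - q 2)))
      * ((ι (7 ℕ.+ m) - ι (suc k)) * (ι (7 ℕ.+ m) - ι k)) * (ι k * ι k) * baseD m k
shift-coeffD-4+ m zero =
  sym (zero-square-factor ((ι (4 ℕ.+ m) * ι (3 ℕ.+ m) * ι (1 ℕ.+ (m ℕ.+ 0)) + ι (2 ℕ.+ m) * ((ι 0 - 1ℚ) * (ι 0 - q 2))) * ((ι (7 ℕ.+ m) - ι 1) * (ι (7 ℕ.+ m) - ι 0))) (baseD m 0))
shift-coeffD-4+ m (suc j) = begin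
  coeffD (4 ℕ.+ m) j                                  ≡⟨ coeffD-closed (1 ℕ.+ m) j ⟩
  p * F * (invFact j * invFact j) * invFactDiff (7 ℕ.+ m) (3 ℕ.+ j)
                                                      ≡⟨ cong₂ (λ r d → p * F * (r * r) * d) (invFact-suc j)
                                                           (trans (invFactDiff-suc (7 ℕ.+ m) (2 ℕ.+ j)) (cong (δ₁ *_) (invFactDiff-suc (7 ℕ.+ m) (suc j)))) ⟩
  p * F * ((ι (suc j) * i) * (ι (suc j) * i)) * (δ₁ * (δ₀ * D))
                                                      ≡⟨ regroup (ι (4 ℕ.+ m)) (ι (3 ℕ.+ m)) (ι (2 ℕ.+ m)) (ι j) F i δ₁ δ₀ D (ι Y) (cong ι (ℕ.+-suc m j)) (cong (λ n → ι (n !)) (ℕ.+-suc m j)) ⟩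
  (ι (4 ℕ.+ m) * ι (3 ℕ.+ m) * ι (1 ℕ.+ X) + ι (2 ℕ.+ m) * ((ι (suc j) - 1ℚ) * (ι (suc j) - q 2)))
    * (δ₁ * δ₀) * (ι (suc j) * ι (suc j)) * baseD m (suc j) ∎
  where
  X = m ℕ.+ suc j
  Y = m ℕ.+ j
  p = ι (4 ℕ.+ m) * ι (3 ℕ.+ m) * ι (2 ℕ.+ Y) + ι (2 ℕ.+ m) * (ι j * (ι j - 1ℚ))
  δ₁ = ι (7 ℕ.+ m) - ι (2 ℕ.+ j)
  δ₀ = ι (7 ℕ.+ m) - ι (suc j)
  F = ι (suc Y !)
  i = invFact (suc j)
  D = invFactDiff (7 ℕ.+ m) (suc j)
  regroup : ∀ c₄ c₃ c₂ J F i δ₁ δ₀ D τ {σ F′} → σ ≡ 1ℚ + τ → F′ ≡ F →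
    (c₄ * c₃ * (1ℚ + (1ℚ + τ)) + c₂ * (J * (J - 1ℚ))) * F * (((1ℚ + J) * i) * ((1ℚ + J) * i)) * (δ₁ * (δ₀ * D))
    ≡ (c₄ * c₃ * (1ℚ + σ) + c₂ * (((1ℚ + J) - 1ℚ) * ((1ℚ + J) - q 2)))
      * (δ₁ * δ₀) * ((1ℚ + J) * (1ℚ + J)) * (F′ * (i * i) * D)
  regroup c₄ c₃ c₂ J F i δ₁ δ₀ D τ refl refl = solve (c₄ ∷ c₃ ∷ c₂ ∷ J ∷ F ∷ i ∷ δ₁ ∷ δ₀ ∷ D ∷ τ ∷ []) ℚ-ring

shift²-coeffD-5+ : ∀ m k → let X = m ℕ.+ k in
  shift (shift (coeffD (5 ℕ.+ m))) k
    ≡ (ι (5 ℕ.+ m) * ι (4 ℕ.+ m) * ι (1 ℕ.+ X) + ι (3 ℕ.+ m) * ((ι k - q 2) * (ι k - q 3)))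
      * ((ι k * (ι k - 1ℚ)) * (ι k * (ι k - 1ℚ))) * baseD m k
shift²-coeffD-5+ m zero =
  sym (vanish₀ (ι (5 ℕ.+ m) * ι (4 ℕ.+ m) * ι (1 ℕ.+ (m ℕ.+ 0)) + ι (3 ℕ.+ m) * ((ι 0 - q 2) * (ι 0 - q 3))) (baseD m 0))
  where
  vanish₀ : ∀ a b → a * ((ι 0 * (ι 0 - 1ℚ)) * (ι 0 * (ι 0 - 1ℚ))) * b ≡ 0ℚ
  vanish₀ = solve-∀ ℚ-ring
shift²-coeffD-5+ m (suc zero) =
  sym (vanish₁ (ι (5 ℕ.+ m) * ι (4 ℕ.+ m) * ι (1 ℕ.+ (m ℕ.+ 1)) + ι (3 ℕ.+ m) * ((ι 1 - q 2) * (ι 1 - q 3))) (baseD m 1))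
  where
  vanish₁ : ∀ a b → a * ((ι 1 * (ι 1 - 1ℚ)) * (ι 1 * (ι 1 - 1ℚ))) * b ≡ 0ℚ
  vanish₁ = solve-∀ ℚ-ring
shift²-coeffD-5+ m (suc (suc j)) = begin
  coeffD (5 ℕ.+ m) j                                  ≡⟨ coeffD-closed (2 ℕ.+ m) j ⟩
  p * F * (invFact j * invFact j) * D                 ≡⟨ cong (λ r → p * F * (r * r) * D) (trans (invFact-suc j) (cong (ι (suc j) *_) (invFact-suc (suc j)))) ⟩
  p * F * ((ι (suc j) * (ι (2 ℕ.+ j) * i)) * (ι (suc j) * (ι (2 ℕ.+ j) * i))) * D
                                                      ≡⟨ regroup (ι (5 ℕ.+ m)) (ι (4 ℕ.+ m)) (ι (3 ℕ.+ m)) (ι j) F i D (ι Y)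
                                                           (cong ι (trans (ℕ.+-suc m (suc j)) (cong suc (ℕ.+-suc m j))))
                                                           (cong (λ n → ι (n !)) (trans (ℕ.+-suc m (suc j)) (cong suc (ℕ.+-suc m j)))) ⟩
  (ι (5 ℕ.+ m) * ι (4 ℕ.+ m) * ι (1 ℕ.+ X) + ι (3 ℕ.+ m) * ((ι (2 ℕ.+ j) - q 2) * (ι (2 ℕ.+ j) - q 3)))
    * ((ι (2 ℕ.+ j) * (ι (2 ℕ.+ j) - 1ℚ)) * (ι (2 ℕ.+ j) * (ι (2 ℕ.+ j) - 1ℚ))) * baseD m (2 ℕ.+ j) ∎
  where
  X = m ℕ.+ suc (suc j)
  Y = m ℕ.+ j
  p = ι (5 ℕ.+ m) * ι (4 ℕ.+ m) * ι (3 ℕ.+ Y) + ι (3 ℕ.+ m) * (ι j * (ι j - 1ℚ))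
  F = ι ((2 ℕ.+ Y) !)
  i = invFact (2 ℕ.+ j)
  D = invFactDiff (7 ℕ.+ m) (2 ℕ.+ j)
  regroup : ∀ c₅ c₄ c₃ J F i D τ {σ F′} → σ ≡ 1ℚ + (1ℚ + τ) → F′ ≡ F →
    let K = 1ℚ + (1ℚ + J) in
    (c₅ * c₄ * (1ℚ + (1ℚ + (1ℚ + τ))) + c₃ * (J * (J - 1ℚ))) * F * (((1ℚ + J) * (K * i)) * ((1ℚ + J) * (K * i))) * D
      ≡ (c₅ * c₄ * (1ℚ + σ) + c₃ * ((K - q 2) * (K - q 3))) * ((K * (K - 1ℚ)) * (K * (K - 1ℚ))) * (F′ * (i * i) * D)
  regroup c₅ c₄ c₃ J F i D τ refl refl = solve (c₅ ∷ c₄ ∷ c₃ ∷ J ∷ F ∷ i ∷ D ∷ τ ∷ []) ℚ-ring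

Qd-factorisation : ∀ m → Qd (4 ℕ.+ m) ≡ ι (7 ℕ.+ m) * (q 2016 + ι m * (q 1748 + ι m * (q 481 + ι m * q 43)))
Qd-factorisation m = factor (ι m) (sym (ι≡q (4 ℕ.+ m)))
  where
  factor : ∀ M {ℓ} →
    let sq x = x * (x * 1ℚ)
        cube x = x * sq x
        M₄ = 1ℚ + (1ℚ + (1ℚ + (1ℚ + M)))
    in ℓ ≡ M₄ →
       (ℓ + q 3) * (q 43 * cube ℓ - q 35 * sq ℓ - q 36 * ℓ - q 32)
         ≡ (1ℚ + (1ℚ + (1ℚ + M₄))) * (q 2016 + M * (q 1748 + M * (q 481 + M * q 43)))
  factor M refl = solve (M ∷ []) ℚ-ring

Qd≢0 : ∀ m → Qd (4 ℕ.+ m) ≢ 0ℚ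
Qd≢0 m Qd≡0 = *-≢0 (ι≢0 (7 ℕ.+ m)) (λ h → q≢0 h₀ (trans cofactor h)) (trans (sym (Qd-factorisation m)) Qd≡0)
  where
  h₂ = 481 ℕ.+ m ℕ.* 43
  h₁ = 1748 ℕ.+ m ℕ.* h₂
  h₀ = 2016 ℕ.+ m ℕ.* h₁
  q-step : ∀ c h → q (c ℕ.+ m ℕ.* h) ≡ q c + ι m * q h
  q-step c h = trans (q-+ c (m ℕ.* h)) (cong (q c +_) (trans (q-* m h) (cong (_* q h) (sym (ι≡q m)))))
  cofactor : q h₀ ≡ q 2016 + ι m * (q 1748 + ι m * (q 481 + ι m * q 43))
  cofactor = begin
    q h₀                                                  ≡⟨ q-step 2016 h₁ ⟩
    q 2016 + ι m * q h₁                                   ≡⟨ cong (λ x → q 2016 + ι m * x) (q-step 1748 h₂) ⟩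
    q 2016 + ι m * (q 1748 + ι m * q h₂)                  ≡⟨ cong (λ x → q 2016 + ι m * (q 1748 + ι m * x)) (q-step 481 43) ⟩
    q 2016 + ι m * (q 1748 + ι m * (q 481 + ι m * q 43))  ∎

-- At the use site Q is Qd l, in the factored form of Qd-factorisation, and A, β, …, G are Qd l
-- times aD l, …, gD l, i.e. the numerators in Defs; sq and cube unfold like _^'_, so that these
-- match definitionally.
coeffD-recurrence-normalised : ∀ M K S B {ℓ Q A β C δ E F G X₃₀ X₂₀ X₂₁ X₁₀ X₁₁ X₁₂ X₀₀ X₀₁} →
  let sq x = x * (x * 1ℚ)
      cube x = x * sq x
      M₁ = 1ℚ + M
      M₂ = 1ℚ + M₁
      M₃ = 1ℚ + M₂
      M₄ = 1ℚ + M₃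
      M₅ = 1ℚ + M₄
      M₆ = 1ℚ + M₅
      M₇ = 1ℚ + M₆
      S₁ = 1ℚ + S
      S₂ = 1ℚ + S₁
      S₃ = 1ℚ + S₂
      S₄ = 1ℚ + S₃
      S₅ = 1ℚ + S₄
      K₁ = 1ℚ + K
      K₂ = 1ℚ + K₁
  in S ≡ M + K → ℓ ≡ M₄ →
     Q ≡ M₇ * (q 2016 + M * (q 1748 + M * (q 481 + M * q 43))) →
     A ≡ (ℓ + q 2) * (q 43 * cube ℓ - q 78 * sq ℓ - q 129 * ℓ - q 24) →
     β ≡ - (q 86 * (ℓ * cube ℓ) + q 145 * cube ℓ - q 196 * sq ℓ - q 623 * ℓ - q 456) →
     C ≡ ℓ * (q 43 * cube ℓ + q 180 * sq ℓ + q 45 * ℓ + q 56) →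
     δ ≡ - (q 2 * ℓ * (q 172 * cube ℓ + q 333 * sq ℓ - q 23 * ℓ - q 32)) →
     E ≡ q 2 * (q 2 * ℓ - q 1) * (q 2 * ℓ + q 1) * (q 43 * sq ℓ + q 51 * ℓ - q 24) →
     F ≡ - ((ℓ - q 1) * (q 43 * cube ℓ + q 137 * sq ℓ + q 38 * ℓ - q 48)) →
     G ≡ (ℓ - q 1) * (q 2 * ℓ + q 1) * (q 43 * sq ℓ + q 51 * ℓ - q 24) →
     X₃₀ ≡ (M₇ * M₆ * S₅ + M₅ * (K * (K - 1ℚ))) * (S₄ * (S₃ * (S₂ * S₁))) * B →
     X₂₀ ≡ (M₆ * M₅ * S₄ + M₄ * (K * (K - 1ℚ))) * (S₃ * (S₂ * S₁)) * (M₇ - K) * B →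
     X₂₁ ≡ (M₆ * M₅ * S₃ + M₄ * ((K - 1ℚ) * (K - q 2))) * (S₂ * S₁) * (K * K) * B →
     X₁₀ ≡ (M₅ * M₄ * S₃ + M₃ * (K * (K - 1ℚ))) * (S₂ * S₁) * ((M₇ - K₁) * (M₇ - K)) * B →
     X₁₁ ≡ (M₅ * M₄ * S₂ + M₃ * ((K - 1ℚ) * (K - q 2))) * S₁ * (M₇ - K) * (K * K) * B →
     X₁₂ ≡ (M₅ * M₄ * S₁ + M₃ * ((K - q 2) * (K - q 3))) * ((K * (K - 1ℚ)) * (K * (K - 1ℚ))) * B →
     X₀₀ ≡ (M₄ * M₃ * S₂ + M₂ * (K * (K - 1ℚ))) * S₁ * ((M₇ - K₂) * ((M₇ - K₁) * (M₇ - K))) * B →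
     X₀₁ ≡ (M₄ * M₃ * S₁ + M₂ * ((K - 1ℚ) * (K - q 2))) * ((M₇ - K₁) * (M₇ - K)) * (K * K) * B →
     Q * X₃₀ + 0ℚ
       ≡ A * X₂₀ + (- β * X₂₁ + 0ℚ)
         + ((C * X₁₀ + (- δ * X₁₁ + (E * X₁₂ + 0ℚ))) + (F * X₀₀ + (- G * X₀₁ + 0ℚ)))
coeffD-recurrence-normalised M K S B refl refl refl refl refl refl refl refl refl refl
  refl refl refl refl refl refl refl refl = solve (M ∷ K ∷ B ∷ []) ℚ-ring

coeffD-recurrence : ∀ l → 4 ≤ l → ∀ k →
  ((Qd l ∷ []) ⋆ coeffD (l ℕ.+ 3)) k
    ≡ ((Qd l * aD l ∷ - (Qd l * bD l) ∷ []) ⋆ coeffD (l ℕ.+ 2)) k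
      + (((Qd l * cD l ∷ - (Qd l * dD l) ∷ Qd l * eD l ∷ []) ⋆ coeffD (l ℕ.+ 1)) k
         + ((Qd l * fD l ∷ - (Qd l * gD l) ∷ []) ⋆ coeffD l) k)
coeffD-recurrence l@(suc (suc (suc (suc m)))) (s≤s (s≤s (s≤s (s≤s z≤n)))) k =
  coeffD-recurrence-normalised (ι m) (ι k) (ι (m ℕ.+ k)) (baseD m k)
    (ι-+ m k) (sym (ι≡q l)) (Qd-factorisation m)
    (*-÷'-cancel (Qd l) _ Q≢0) (*-neg-÷'-cancel (Qd l) _ Q≢0)
    (*-÷'-cancel (Qd l) _ Q≢0) (*-neg-÷'-cancel (Qd l) _ Q≢0) (*-÷'-cancel (Qd l) _ Q≢0)
    (*-neg-÷'-cancel (Qd l) _ Q≢0) (*-÷'-cancel (Qd l) _ Q≢0)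
    (trans (cong (λ n → coeffD (4 ℕ.+ n) k) (ℕ.+-comm m 3)) (coeffD-7+ m k))
    (trans (cong (λ n → coeffD (4 ℕ.+ n) k) (ℕ.+-comm m 2)) (coeffD-6+ m k))
    (trans (cong (λ n → shift (coeffD (4 ℕ.+ n)) k) (ℕ.+-comm m 2)) (shift-coeffD-6+ m k))
    (trans (cong (λ n → coeffD (4 ℕ.+ n) k) (ℕ.+-comm m 1)) (coeffD-5+ m k))
    (trans (cong (λ n → shift (coeffD (4 ℕ.+ n)) k) (ℕ.+-comm m 1)) (shift-coeffD-5+ m k))
    (trans (cong (λ n → shift (shift (coeffD (4 ℕ.+ n))) k) (ℕ.+-comm m 1)) (shift²-coeffD-5+ m k))
    (coeffD-4+ m k)
    (shift-coeffD-4+ m k)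
  where
  Q≢0 = Qd≢0 m

D-recurrence : ∀ l → 4 ≤ l → ∀ t →
  ND (l ℕ.+ 3) t
    ≡ (aD l + bD l * t) * ND (l ℕ.+ 2) t
      + (cD l + dD l * t + eD l * (t * t)) * ND (l ℕ.+ 1) t
      + (fD l + gD l * t) * ND l t
D-recurrence l@(suc (suc (suc (suc m)))) l≥4@(s≤s (s≤s (s≤s (s≤s z≤n)))) t = *-cancelˡ (Qd≢0 m) (begin
  Qd l * ND (l ℕ.+ 3) t
    ≡⟨ to-horner (Qd l) x (ND (l ℕ.+ 3) t) ⟩
  horner p₃ x * ND (l ℕ.+ 3) t
    ≡⟨ cong (horner p₃ x *_) (alternating-eval (l ℕ.+ 3) (coeffD (l ℕ.+ 3)) t) ⟩
  horner p₃ x * eval (l ℕ.+ 3) (coeffD (l ℕ.+ 3)) x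
    ≡⟨ coefficients⇒eval₃ p₃ p₂ p₁ p₀ x
         (coeffD-vanishes (suc (m ℕ.+ 3))) (coeffD-vanishes (suc (m ℕ.+ 2))) (coeffD-vanishes (suc (m ℕ.+ 1))) (coeffD-vanishes (suc m))
         (+-interchange-≤ 1 l 3) (+-interchange-≤ 2 l 2) (+-interchange-≤ 3 l 1) (+-comm-≤ l (s≤s (s≤s z≤n)))
         (coeffD-recurrence l l≥4) ⟩
  horner p₂ x * eval (l ℕ.+ 2) (coeffD (l ℕ.+ 2)) x
    + (horner p₁ x * eval (l ℕ.+ 1) (coeffD (l ℕ.+ 1)) x + horner p₀ x * eval l (coeffD l) x)
    ≡⟨ sym (cong₂ (λ X₂ X₁₀ → horner p₂ x * X₂ + X₁₀) (alternating-eval (l ℕ.+ 2) (coeffD (l ℕ.+ 2)) t)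
             (cong₂ (λ X₁ X₀ → horner p₁ x * X₁ + horner p₀ x * X₀) (alternating-eval (l ℕ.+ 1) (coeffD (l ℕ.+ 1)) t) (alternating-eval l (coeffD l) t))) ⟩
  horner p₂ x * ND (l ℕ.+ 2) t + (horner p₁ x * ND (l ℕ.+ 1) t + horner p₀ x * ND l t)
    ≡⟨ from-horner (Qd l) (aD l) (bD l) (cD l) (dD l) (eD l) (fD l) (gD l) t (ND (l ℕ.+ 2) t) (ND (l ℕ.+ 1) t) (ND l t) ⟩
  Qd l * ((aD l + bD l * t) * ND (l ℕ.+ 2) t + (cD l + dD l * t + eD l * (t * t)) * ND (l ℕ.+ 1) t + (fD l + gD l * t) * ND l t) ∎)
  where
  x = - t
  p₃ = Qd l ∷ []
  p₂ = Qd l * aD l ∷ - (Qd l * bD l) ∷ []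
  p₁ = Qd l * cD l ∷ - (Qd l * dD l) ∷ Qd l * eD l ∷ []
  p₀ = Qd l * fD l ∷ - (Qd l * gD l) ∷ []
  to-horner : ∀ Q x E → Q * E ≡ (Q + x * 0ℚ) * E
  to-horner = solve-∀ ℚ-ring
  from-horner : ∀ Q a b c d e f g t X₂ X₁ X₀ →
    (Q * a + - t * (- (Q * b) + - t * 0ℚ)) * X₂
      + ((Q * c + - t * (- (Q * d) + - t * (Q * e + - t * 0ℚ))) * X₁ + (Q * f + - t * (- (Q * g) + - t * 0ℚ)) * X₀)
    ≡ Q * ((a + b * t) * X₂ + (c + d * t + e * (t * t)) * X₁ + (f + g * t) * X₀)
  from-horner = solve-∀ ℚ-ring

theorem3p1 :
    ((l : ℕ) → 1 ≤ l → (t : ℚ) →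
      q (l Data.Nat.+ 3) * NA (l Data.Nat.+ 2) t
        ≡ - (q (2 Data.Nat.* l Data.Nat.+ 3) * (q 2 * t - q 1) * NA (l Data.Nat.+ 1) t) - q l * NA l t)
  × ((l : ℕ) → 2 ≤ l → (t : ℚ) →
      q (l Data.Nat.+ 2) * NB (l Data.Nat.+ 2) t
        ≡ - (q (2 Data.Nat.* l Data.Nat.+ 3)
               * (q 2 * t - (q 2 * q (2 Data.Nat.* l Data.Nat.* l Data.Nat.+ 4 Data.Nat.* l Data.Nat.+ 1))
                              ÷' (q (2 Data.Nat.* l Data.Nat.+ 1) * q (2 Data.Nat.* l Data.Nat.+ 3)))
               * NB (l Data.Nat.+ 1) t)
          - ((q l * q (2 Data.Nat.* l Data.Nat.+ 3)) ÷' q (2 Data.Nat.* l Data.Nat.+ 1)) * NB l t)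
  × ((l : ℕ) → 4 ≤ l → (t : ℚ) →
      ND (l Data.Nat.+ 3) t
        ≡ (aD l + bD l * t) * ND (l Data.Nat.+ 2) t
          + (cD l + dD l * t + eD l * (t * t)) * ND (l Data.Nat.+ 1) t
          + (fD l + gD l * t) * ND l t)
theorem3p1 = A-recurrence , (λ l l≥2 → B-recurrence l (ℕ.≤-trans (s≤s z≤n) l≥2)) , D-recurrence
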